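{- Let $G$ be a graph and $(T,\beta)$ a tree-decomposition of $G$ such that (1) for every node $t\in V(T)$ the torso of $t$ has basis number at most $b$, and (2) there is a family $\mathcal{P}$ of paths of $G$ capturing the adhesions of $(T,\beta)$ with edge-congestion at most $c$. Then $\mathrm{bn}(G)\le(2c+1)(b+1)$.
   Context: All graphs are finite and simple. Basis number: subsets of $E(G)$ form an $\mathbb{F}_2$-vector space under symmetric difference; an $\mathbb{F}_2$-cycle is a subgraph with all degrees even; these form the cycle space, a cycle basis is a basis of it; the congestion of a family of subgraphs is the maximum over edges $e$ of the number of members containing $e$ (counted with multiplicity); $\mathrm{bn}(G)$ is the minimum congestion of a cycle basis. A tree-decomposition $(T,\beta)$ has a rooted tree $T$ and bags $\beta(t)\subseteq V(G)$ such that every vertex lies in a bag, every edge lies within a bag, and bags containing any given vertex form a connected subtree. The adhesion of $t$ is $\beta(t)\cap\beta(\text{parent}(t))$ (empty for the root). The torso of $t$ is $G[\beta(t)]$ with an edge $uv$ added for every pair $u,v$ lying in the adhesion of $t$ or of a child of $t$. A multiset $\mathcal{P}$ of paths captures the adhesions of $(T,\beta)$ if it consists of paths $P_{t,u,v}$, one for each node $t$ and each pair of distinct vertices $u,v$ in the adhesion of $t$, where $P_{t,u,v}$ is any path in $G$ from $u$ to $v$ (different indices may give equal paths). Its congestion is $\max_{e\in E(G)}|\{(t,u,v): e\in P_{t,u,v}\}|$. -}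

module Defs where

open import Data.Nat using (ℕ; zero; suc; _+_; _*_; _≤_; _<_; _%_; _<ᵇ_)
open import Data.Fin using (Fin; zero; suc; toℕ; _≟_)
open import Data.Bool using (Bool; true; false; _∧_; _∨_; not; if_then_else_; _xor_)
open import Data.List using (List; []; _∷_)
open import Data.List.Relation.Unary.Unique.Propositional using (Unique)
open import Data.Product using (Σ; ∃; _×_; _,_)
open import Data.Sum using (_⊎_)
open import Function using (_∘_)
open import Relation.Nullary.Decidable using (⌊_⌋)
open import Relation.Binary.PropositionalEquality using (_≡_)

sumFin : ∀ {k} → (Fin k → ℕ) → ℕ
sumFin {zero}  f = 0
sumFin {suc k} f = f zero + sumFin (λ i → f (suc i))

count : ∀ {k} → (Fin k → Bool) → ℕ
count f = sumFin (λ i → if f i then 1 else 0)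

anyFin : ∀ {k} → (Fin k → Bool) → Bool
anyFin {zero}  f = false
anyFin {suc k} f = f zero ∨ anyFin (λ i → f (suc i))

_==_ : ∀ {n} → Fin n → Fin n → Bool
u == v = ⌊ u ≟ v ⌋

Adj : ℕ → Set
Adj n = Fin n → Fin n → Bool

record IsGraph {n : ℕ} (adj : Adj n) : Set where
  field
    sym    : ∀ u v → adj u v ≡ adj v u
    irrefl : ∀ u → adj u u ≡ false

ESet : ℕ → Set
ESet n = Fin n → Fin n → Bool

record IsEdgeSubset {n : ℕ} (adj : Adj n) (S : ESet n) : Set where
  field
    sym    : ∀ u v → S u v ≡ S v u
    irrefl : ∀ u → S u u ≡ false
    sub    : ∀ u v → S u v ≡ true → adj u v ≡ true

IsF2Cycle : ∀ {n} → ESet n → Set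
IsF2Cycle S = ∀ v → count (S v) % 2 ≡ 0

combo : ∀ {n k} → (Fin k → Bool) → (Fin k → ESet n) → ESet n
combo {k = zero}  σ B u v = false
combo {k = suc k} σ B u v = (σ zero ∧ B zero u v) xor combo (σ ∘ suc) (B ∘ suc) u v

record IsCycleBasis {n k : ℕ} (adj : Adj n) (B : Fin k → ESet n) : Set where
  field
    members-sub   : ∀ i → IsEdgeSubset adj (B i)
    members-cycle : ∀ i → IsF2Cycle (B i)
    independent   : ∀ (σ : Fin k → Bool) → (∀ u v → combo σ B u v ≡ false) → ∀ i → σ i ≡ false
    spanning      : ∀ (S : ESet n) → IsEdgeSubset adj S → IsF2Cycle S →
                    Σ (Fin k → Bool) λ σ → ∀ u v → combo σ B u v ≡ S u v

CongestionAtMost : ∀ {n k} → (Fin k → ESet n) → ℕ → Set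
CongestionAtMost B c = ∀ u v → count (λ i → B i u v) ≤ c

-- bn(G) ≤ b  (bn is a minimum over cycle bases, which always exist)
BnAtMost : ∀ {n} → Adj n → ℕ → Set
BnAtMost {n} adj b =
  Σ ℕ λ k → Σ (Fin k → ESet n) λ B → IsCycleBasis adj B × CongestionAtMost B b

data Walk {A : Set} (R : A → A → Set) (P : A → Set) : A → A → Set where
  here : ∀ {a} → P a → Walk R P a a
  step : ∀ {a b c} → P a → R a b → Walk R P b c → Walk R P a c

-- The rooted tree T has nodes Fin (suc m), root zero, and the parent of
-- node (suc i) is par i, with toℕ (par i) ≤ toℕ i (every finite rooted
-- tree admits such a labelling, e.g. BFS order).

record TreeDecomposition {n : ℕ} (adj : Adj n) : Set where
  field
    m       : ℕ
    par     : Fin m → Fin (suc m)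
    par-ord : ∀ i → toℕ (par i) ≤ toℕ i
    bag     : Fin (suc m) → Fin n → Bool

  TAdj : Fin (suc m) → Fin (suc m) → Set
  TAdj a b = (∃ λ i → a ≡ suc i × par i ≡ b) ⊎ (∃ λ i → b ≡ suc i × par i ≡ a)

  field
    covers    : ∀ v → ∃ λ t → bag t v ≡ true
    edges     : ∀ u v → adj u v ≡ true → ∃ λ t → bag t u ≡ true × bag t v ≡ true
    connected : ∀ v t₁ t₂ → bag t₁ v ≡ true → bag t₂ v ≡ true →
                Walk TAdj (λ t → bag t v ≡ true) t₁ t₂

module _ {n : ℕ} {adj : Adj n} (D : TreeDecomposition adj) where
  open TreeDecomposition D

  adhesion : Fin (suc m) → Fin n → Bool
  adhesion zero    v = false
  adhesion (suc i) v = bag (suc i) v ∧ bag (par i) v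

  isChildOf : Fin (suc m) → Fin (suc m) → Bool
  isChildOf zero    t = false
  isChildOf (suc i) t = par i == t

  -- torso of t, as a graph on Fin n in which vertices outside β(t) are isolated
  torso : Fin (suc m) → Adj n
  torso t u v =
    bag t u ∧ bag t v ∧ not (u == v) ∧
    (adj u v ∨ (adhesion t u ∧ adhesion t v) ∨
     anyFin (λ s → isChildOf s t ∧ adhesion s u ∧ adhesion s v))

  -- a family of paths indexed by (t, u, v); only the entries with
  -- toℕ u < toℕ v and u, v in the adhesion of t are used
  -- (one path per node and unordered pair of distinct adhesion vertices)
  PathFamily : Set
  PathFamily = Fin (suc m) → Fin n → Fin n → List (Fin n)

data VWalk {n : ℕ} (adj : Adj n) : Fin n → Fin n → List (Fin n) → Set where
  single : ∀ u → VWalk adj u u (u ∷ [])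
  cons   : ∀ {u w v xs} → adj u w ≡ true → VWalk adj w v xs → VWalk adj u v (u ∷ xs)

IsPath : ∀ {n} → Adj n → Fin n → Fin n → List (Fin n) → Set
IsPath adj u v xs = VWalk adj u v xs × Unique xs

hasEdge : ∀ {n} → Fin n → Fin n → List (Fin n) → Bool
hasEdge x y (a ∷ b ∷ r) = ((a == x) ∧ (b == y)) ∨ ((a == y) ∧ (b == x)) ∨ hasEdge x y (b ∷ r)
hasEdge x y _ = false

module _ {n : ℕ} {adj : Adj n} (D : TreeDecomposition adj) where
  open TreeDecomposition D

  CapturesAdhesions : PathFamily D → Set
  CapturesAdhesions P = ∀ t u v → toℕ u < toℕ v →
    adhesion D t u ≡ true → adhesion D t v ≡ true → IsPath adj u v (P t u v)

  PathCongestionAtMost : PathFamily D → ℕ → Set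
  PathCongestionAtMost P c = ∀ x y →
    sumFin (λ t → sumFin (λ u → count (λ v →
      (toℕ u <ᵇ toℕ v) ∧ adhesion D t u ∧ adhesion D t v ∧ hasEdge x y (P t u v)))) ≤ c

-- Each basis element of a torso is transported to G by replacing every torso edge xy by an x–y
-- join: the edge xy itself, the adhesion path P(t,x,y), or the adhesion path at the child of t whose
-- adhesion produced the edge. For every pair xy, the sums of consecutive joins among the edge xy and
-- the paths P(s,x,y) are added. The resulting family spans the cycle space: a cycle is generated node
-- by node from the leaves towards the root, the part at node t becoming a cycle of the torso of t once
-- a star on its odd vertices, which all lie in the adhesion of t, is added. An edge uv lies in at most
-- b(p + 1 + p) transported basis elements and in at most 1 + 2p consecutive sums, where p ≤ c counts
-- the adhesion paths through uv; an independent subfamily with the same span is the basis.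

module Submission where

open import Defs
open import Algebra.Bundles using (CommutativeRing)
import Algebra.Properties.CommutativeSemigroup as CommutativeSemigroupProperties
import Algebra.Properties.Semiring.Sum as SemiringSum
open import Data.Bool using (Bool; true; false; _∧_; _∨_; not; if_then_else_; _xor_; T)
open import Data.Bool.Properties
  using (xor-assoc; xor-comm; xor-same; xor-identityʳ; ∧-comm; ∧-assoc; ∧-zeroʳ; ∧-identityʳ;
         ∧-distribˡ-xor; ∧-distribʳ-xor; xor-∧-commutativeRing)
  renaming (_≟_ to _≟ᵇ_)
open import Data.Bool.Solver using (module xor-∧-Solver)
open import Data.Empty using (⊥; ⊥-elim)
open import Data.Fin using (Fin; zero; suc; toℕ; fromℕ<; _≟_)
open import Data.Fin.Properties using (toℕ-injective; toℕ-fromℕ<; toℕ<n; suc-injective; all?; any?)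
open import Data.List using (List; []; _∷_; _++_; concat; tabulate; length; lookup)
open import Data.List.Membership.Propositional using (_∈_)
open import Data.List.Membership.Propositional.Properties using (∈-++⁺ˡ; ∈-++⁺ʳ; ∈-concat⁺′; ∈-tabulate⁺; ∈-lookup)
open import Data.List.Relation.Unary.All as All using (All; []; _∷_)
import Data.List.Relation.Unary.All.Properties as AllP
open import Data.List.Relation.Unary.AllPairs using ([]; _∷_)
open import Data.List.Relation.Unary.Any using (here; there)
open import Data.List.Relation.Unary.Unique.Propositional using (Unique)
open import Data.Nat using (ℕ; zero; suc; _+_; _*_; _≤_; _<_; _%_; _<ᵇ_; z≤n; s≤s)
open import Data.Nat.DivMod using (%-distribˡ-+)
open import Data.Nat.Properties hiding (_≟_; suc-injective)
open import Data.Nat.Tactic.RingSolver using (solve-∀)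
open import Data.Product using (Σ; ∃; _×_; _,_; proj₁; proj₂)
open import Data.Sum using (_⊎_; inj₁; inj₂; [_,_])
open import Data.Unit using (tt)
open import Data.Vec.Functional using () renaming (_∷_ to _◂_)
open import Function using (_∘_)
open import Relation.Binary.Definitions using (tri<; tri≈; tri>)
open import Relation.Binary.PropositionalEquality
open import Relation.Nullary using (¬_; yes; no; Dec)
open import Relation.Nullary.Decidable using (dec-true; dec-false; isYes≗does)

open SemiringSum +-*-semiring using (sum; sum-syntax; ∑-distrib-+; ∑-comm; sum-cong-≗; *-distribˡ-sum)
open SemiringSum (CommutativeRing.semiring xor-∧-commutativeRing)
  using () renaming (sum to ⨁; sum-cong-≗ to ⨁-cong; ∑-distrib-+ to ⨁-distrib-xor; ∑-comm to ⨁-comm;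
                     *-distribˡ-sum to ∧-distribˡ-sum)
open CommutativeSemigroupProperties (CommutativeRing.+-commutativeSemigroup xor-∧-commutativeRing)
  using () renaming (interchange to xor-interchange)

⟦_⟧ : Bool → ℕ
⟦ b ⟧ = if b then 1 else 0

false≢true : false ≢ true
false≢true ()

∧-trueˡ : ∀ {a b} → a ∧ b ≡ true → a ≡ true
∧-trueˡ {true} _ = refl

∧-trueʳ : ∀ {a b} → a ∧ b ≡ true → b ≡ true
∧-trueʳ {true} e = e

∧-true : ∀ {a b} → a ≡ true → b ≡ true → a ∧ b ≡ true
∧-true refl refl = refl

∧-absorbʳ : ∀ {a b} → (a ≡ true → b ≡ true) → a ∧ b ≡ a
∧-absorbʳ {false} _ = refl
∧-absorbʳ {true} h = h refl

∨-introˡ : ∀ {a b} → a ≡ true → a ∨ b ≡ true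
∨-introˡ refl = refl

∨-introʳ : ∀ {a b} → b ≡ true → a ∨ b ≡ true
∨-introʳ {false} e = e
∨-introʳ {true} e = refl

xor-true : ∀ {a b} → a xor b ≡ true → a ≡ true ⊎ b ≡ true
xor-true {true} _ = inj₁ refl
xor-true {false} e = inj₂ e

xor-cancel-middle : ∀ a b c → (a xor b) xor (b xor c) ≡ a xor c
xor-cancel-middle = solve 3 (λ a b c → (a :+ b) :+ (b :+ c) := a :+ c) refl
  where open xor-∧-Solver

∧-not≡xor-∧ : ∀ a c → a ∧ not c ≡ a xor (c ∧ a)
∧-not≡xor-∧ false c = sym (∧-zeroʳ c)
∧-not≡xor-∧ true false = refl
∧-not≡xor-∧ true true = refl

∨≡xor-disjoint : ∀ a b c → (a ≡ true → b ≡ true → ⊥) → (a ≡ true → c ≡ true → ⊥) →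
                 (b ≡ true → c ≡ true → ⊥) → a ∨ (b ∨ c) ≡ (a xor b) xor c
∨≡xor-disjoint false false c _ _ _ = refl
∨≡xor-disjoint false true false _ _ _ = refl
∨≡xor-disjoint false true true _ _ bc = ⊥-elim (bc refl refl)
∨≡xor-disjoint true false false _ _ _ = refl
∨≡xor-disjoint true false true _ ac _ = ⊥-elim (ac refl refl)
∨≡xor-disjoint true true c ab _ _ = ⊥-elim (ab refl refl)

⟦⟧-mono : ∀ {a b} → (a ≡ true → b ≡ true) → ⟦ a ⟧ ≤ ⟦ b ⟧
⟦⟧-mono {false} _ = z≤n
⟦⟧-mono {true} h rewrite h refl = ≤-refl

⟦xor⟧≤ : ∀ a b → ⟦ a xor b ⟧ ≤ ⟦ a ⟧ + ⟦ b ⟧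
⟦xor⟧≤ false b = ≤-refl
⟦xor⟧≤ true false = ≤-refl
⟦xor⟧≤ true true = z≤n

⟦∨⟧≤ : ∀ a b → ⟦ a ∨ b ⟧ ≤ ⟦ a ⟧ + ⟦ b ⟧
⟦∨⟧≤ false b = ≤-refl
⟦∨⟧≤ true b = s≤s z≤n

==-refl : ∀ {n} (u : Fin n) → (u == u) ≡ true
==-refl u = trans (isYes≗does (u ≟ u)) (dec-true (u ≟ u) refl)

==-false : ∀ {n} {u v : Fin n} → u ≢ v → (u == v) ≡ false
==-false {u = u} {v} u≢v = trans (isYes≗does (u ≟ v)) (dec-false (u ≟ v) u≢v)

==⇒≡ : ∀ {n} {u v : Fin n} → (u == v) ≡ true → u ≡ v
==⇒≡ {u = u} {v} e with u ≟ v
... | yes p = p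

==-sym : ∀ {n} (u v : Fin n) → (u == v) ≡ (v == u)
==-sym u v with u ≟ v
... | yes refl = sym (==-refl u)
... | no u≢v = sym (==-false (u≢v ∘ sym))

irrefl⇒distinct : ∀ {n} (Z : Fin n → Fin n → Bool) → (∀ z → Z z z ≡ false) → ∀ x y → Z x y ≡ true → (x == y) ≡ false
irrefl⇒distinct Z irrefl x y e with x == y in x=y
... | false = refl
... | true with refl ← ==⇒≡ x=y = ⊥-elim (false≢true (trans (sym (irrefl x)) e))

-- x ≺ y selects one orientation of each unordered pair, as in PathCongestionAtMost
_≺_ : ∀ {n} → Fin n → Fin n → Bool
x ≺ y = toℕ x <ᵇ toℕ y

≺⇒< : ∀ {n} {x y : Fin n} → (x ≺ y) ≡ true → toℕ x < toℕ y
≺⇒< {x = x} {y} e = <ᵇ⇒< (toℕ x) (toℕ y) (subst T (sym e) tt)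

<⇒≺ : ∀ {n} {x y : Fin n} → toℕ x < toℕ y → (x ≺ y) ≡ true
<⇒≺ {x = x} {y} lt with x ≺ y | <⇒<ᵇ lt
... | true | _ = refl

≮⇒≺-false : ∀ {n} {x y : Fin n} → ¬ toℕ x < toℕ y → (x ≺ y) ≡ false
≮⇒≺-false {x = x} {y} x≮y with x ≺ y in e
... | false = refl
... | true = ⊥-elim (x≮y (≺⇒< e))

≺-xor-≻ : ∀ {n} (x y : Fin n) → ((x ≺ y) xor (y ≺ x)) ≡ not (x == y)
≺-xor-≻ x y with <-cmp (toℕ x) (toℕ y)
... | tri< x<y x≢y _ = trans (cong₂ _xor_ (<⇒≺ x<y) (≮⇒≺-false (<-asym x<y)))
                             (sym (cong not (==-false (x≢y ∘ cong toℕ))))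
... | tri≈ _ x≡y _ rewrite toℕ-injective x≡y =
  trans (cong₂ _xor_ (≮⇒≺-false {x = y} {y} (<-irrefl refl)) (≮⇒≺-false {x = y} {y} (<-irrefl refl))) (sym (cong not (==-refl y)))
... | tri> _ x≢y y<x = trans (cong₂ _xor_ (≮⇒≺-false (<-asym y<x)) (<⇒≺ y<x))
                             (sym (cong not (==-false (x≢y ∘ cong toℕ))))

sumFin≡sum : ∀ {k} (f : Fin k → ℕ) → sumFin f ≡ sum f
sumFin≡sum {zero} f = refl
sumFin≡sum {suc k} f = cong (f zero +_) (sumFin≡sum (f ∘ suc))

sum-mono-≤ : ∀ {k} {f g : Fin k → ℕ} → (∀ i → f i ≤ g i) → sum f ≤ sum g
sum-mono-≤ {zero} _ = z≤n
sum-mono-≤ {suc k} f≤g = +-mono-≤ (f≤g zero) (sum-mono-≤ (f≤g ∘ suc))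

sum-scale : ∀ {k} a (f : Fin k → ℕ) → sum (λ i → a * f i) ≡ a * sum f
sum-scale a f = sym (*-distribˡ-sum a f)

∑-rotate : ∀ {a b c} (f : Fin a → Fin b → Fin c → ℕ) →
           ∑[ x < a ] ∑[ y < b ] ∑[ s < c ] f x y s ≡ ∑[ s < c ] ∑[ x < a ] ∑[ y < b ] f x y s
∑-rotate f = trans (sum-cong-≗ λ x → ∑-comm (f x)) (∑-comm λ x s → sum (λ y → f x y s))

sum-zero : ∀ {k} (f : Fin k → ℕ) → (∀ i → f i ≡ 0) → sum f ≡ 0
sum-zero {zero} f _ = refl
sum-zero {suc k} f f≡0 rewrite f≡0 zero = sum-zero (f ∘ suc) (f≡0 ∘ suc)

≤-sum : ∀ {k} (f : Fin k → ℕ) (c : Fin k) → f c ≤ sum f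
≤-sum f zero = m≤m+n _ _
≤-sum f (suc c) = ≤-trans (≤-sum (f ∘ suc) c) (m≤n+m _ (f zero))

sum-single : ∀ {k} (f : Fin k → ℕ) (c : Fin k) → (∀ i → i ≢ c → f i ≡ 0) → sum f ≡ f c
sum-single f zero f≡0 = trans (cong (f zero +_) (sum-zero _ λ i → f≡0 (suc i) λ ())) (+-identityʳ (f zero))
sum-single f (suc c) f≡0 rewrite f≡0 zero (λ ()) = sum-single (f ∘ suc) c λ i i≢c → f≡0 (suc i) (i≢c ∘ suc-injective)

sum-⟦∧⟧-unique : ∀ {k} (g : Fin k → Bool) (e : Bool) → (∀ i j → g i ≡ true → g j ≡ true → i ≡ j) →
                 sum (λ i → ⟦ g i ∧ e ⟧) ≤ ⟦ e ⟧
sum-⟦∧⟧-unique {zero} g e _ = z≤n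
sum-⟦∧⟧-unique {suc k} g false _ = ≤-reflexive (sum-zero _ λ i → cong ⟦_⟧ (∧-zeroʳ (g i)))
sum-⟦∧⟧-unique {suc k} g true unique with g zero in g₀
... | false = sum-⟦∧⟧-unique (g ∘ suc) true λ i j gi gj → suc-injective (unique (suc i) (suc j) gi gj)
... | true = ≤-reflexive (cong suc (sum-zero _ rest))
  where
  rest : ∀ i → ⟦ g (suc i) ∧ true ⟧ ≡ 0
  rest i with g (suc i) in gᵢ
  ... | false = refl
  ... | true with () ← unique zero (suc i) g₀ gᵢ

⨁-false : ∀ {k} (f : Fin k → Bool) → (∀ i → f i ≡ false) → ⨁ f ≡ false
⨁-false {zero} f _ = refl
⨁-false {suc k} f f≡false rewrite f≡false zero = ⨁-false (f ∘ suc) (f≡false ∘ suc)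

⨁-true : ∀ {k} (f : Fin k → Bool) → ⨁ f ≡ true → ∃ λ i → f i ≡ true
⨁-true {suc k} f e with f zero in f₀
... | true = zero , f₀
... | false with i , fᵢ ← ⨁-true (f ∘ suc) e = suc i , fᵢ

∧-distribˡ-⨁ : ∀ {k} b (f : Fin k → Bool) → ⨁ (λ i → b ∧ f i) ≡ b ∧ ⨁ f
∧-distribˡ-⨁ b f = sym (∧-distribˡ-sum b f)

⨁-single : ∀ {k} (f : Fin k → Bool) (c : Fin k) → (∀ i → i ≢ c → f i ≡ false) → ⨁ f ≡ f c
⨁-single f zero f≡false = trans (cong (f zero xor_) (⨁-false _ λ i → f≡false (suc i) λ ())) (xor-identityʳ (f zero))
⨁-single f (suc c) f≡false rewrite f≡false zero (λ ()) =
  ⨁-single (f ∘ suc) c λ i i≢c → f≡false (suc i) (i≢c ∘ suc-injective)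

⨁-select : ∀ {k} (c : Fin k) (f : Fin k → Bool) → ⨁ (λ i → (c == i) ∧ f i) ≡ f c
⨁-select c f = trans (⨁-single _ c λ i i≢c → cong (_∧ f i) (==-false (i≢c ∘ sym)))
                     (cong (_∧ f c) (==-refl c))

⨁-selectʳ : ∀ {k} (c : Fin k) (f : Fin k → Bool) → ⨁ (λ i → f i ∧ (c == i)) ≡ f c
⨁-selectʳ c f = trans (⨁-cong λ i → ∧-comm (f i) (c == i)) (⨁-select c f)

⨁-== : ∀ {k} (c : Fin k) → ⨁ (λ i → c == i) ≡ true
⨁-== c = ⨁-selectʳ c (λ _ → true)

⟦⨁⟧≤sum : ∀ {k} (f : Fin k → Bool) → ⟦ ⨁ f ⟧ ≤ sum (⟦_⟧ ∘ f)
⟦⨁⟧≤sum {zero} f = z≤n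
⟦⨁⟧≤sum {suc k} f = ≤-trans (⟦xor⟧≤ (f zero) (⨁ (f ∘ suc))) (+-monoʳ-≤ ⟦ f zero ⟧ (⟦⨁⟧≤sum (f ∘ suc)))

count-parity : ∀ {k} (f : Fin k → Bool) → count f % 2 ≡ ⟦ ⨁ f ⟧
count-parity {zero} f = refl
count-parity {suc k} f with f zero
... | false = count-parity (f ∘ suc)
... | true = begin
  suc (count (f ∘ suc)) % 2        ≡⟨ %-distribˡ-+ 1 (count (f ∘ suc)) 2 ⟩
  (1 + count (f ∘ suc) % 2) % 2    ≡⟨ cong (λ r → (1 + r) % 2) (count-parity (f ∘ suc)) ⟩
  (1 + ⟦ ⨁ (f ∘ suc) ⟧) % 2        ≡⟨ flip (⨁ (f ∘ suc)) ⟩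
  ⟦ not (⨁ (f ∘ suc)) ⟧            ∎
  where
  open ≡-Reasoning
  flip : ∀ b → (1 + ⟦ b ⟧) % 2 ≡ ⟦ not b ⟧
  flip false = refl
  flip true = refl

even⇒⨁-false : ∀ {k} (f : Fin k → Bool) → count f % 2 ≡ 0 → ⨁ f ≡ false
even⇒⨁-false f even with ⨁ f | count-parity f
... | false | _ = refl
... | true | odd with () ← trans (sym odd) even

⨁-false⇒even : ∀ {k} (f : Fin k → Bool) → ⨁ f ≡ false → count f % 2 ≡ 0
⨁-false⇒even f e = trans (count-parity f) (cong ⟦_⟧ e)

handshake : ∀ {k} (C : Fin k → Fin k → Bool) → (∀ x y → C x y ≡ C y x) → (∀ x → C x x ≡ false) →
            ⨁ (λ v → ⨁ (C v)) ≡ false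
handshake {zero} C _ _ = refl
handshake {suc k} C symm irrefl = begin
  (C zero zero xor R) xor ⨁ (λ v → C (suc v) zero xor ⨁ (λ w → C (suc v) (suc w)))
    ≡⟨ cong ((C zero zero xor R) xor_) (⨁-distrib-xor (λ v → C (suc v) zero) _) ⟩
  (C zero zero xor R) xor (R′ xor ⨁ (λ v → ⨁ (λ w → C (suc v) (suc w))))
    ≡⟨ cong₂ (λ c r → (c xor R) xor (R′ xor r)) (irrefl zero)
             (handshake (λ v w → C (suc v) (suc w)) (λ x y → symm (suc x) (suc y)) (irrefl ∘ suc)) ⟩
  R xor (R′ xor false)
    ≡⟨ cong (λ r → R xor (r xor false)) (⨁-cong λ v → symm (suc v) zero) ⟩
  R xor (R xor false)
    ≡⟨ trans (sym (xor-assoc R R false)) (cong (_xor false) (xor-same R)) ⟩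
  false ∎
  where
  open ≡-Reasoning
  R R′ : Bool
  R = ⨁ (λ w → C zero (suc w))
  R′ = ⨁ (λ v → C (suc v) zero)

module _ {n : ℕ} where

  infixl 6 _⊕_
  infix 4 _≐_

  _⊕_ : ESet n → ESet n → ESet n
  (S ⊕ T) u v = S u v xor T u v

  ∅ : ESet n
  ∅ u v = false

  _≐_ : ESet n → ESet n → Set
  S ≐ T = ∀ u v → S u v ≡ T u v

  ≐-sym : ∀ {S T} → S ≐ T → T ≐ S
  ≐-sym e u v = sym (e u v)

  ≐-trans : ∀ {S T U} → S ≐ T → T ≐ U → S ≐ U
  ≐-trans e f u v = trans (e u v) (f u v)

  ⊕-cong : ∀ {S S′ T T′} → S ≐ S′ → T ≐ T′ → S ⊕ T ≐ S′ ⊕ T′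
  ⊕-cong e f u v = cong₂ _xor_ (e u v) (f u v)

  ⊕-interchange : ∀ (S T U W : ESet n) → (S ⊕ T) ⊕ (U ⊕ W) ≐ (S ⊕ U) ⊕ (T ⊕ W)
  ⊕-interchange S T U W u v = xor-interchange (S u v) (T u v) (U u v) (W u v)

  Even : ESet n → Set
  Even S = ∀ v → ⨁ (S v) ≡ false

  data InSpan (L : List (ESet n)) : ESet n → Set where
    span-∅ : ∀ {S} → S ≐ ∅ → InSpan L S
    span-∈ : ∀ {S} T → T ∈ L → S ≐ T → InSpan L S
    span-⊕ : ∀ {S} T U → InSpan L T → InSpan L U → S ≐ T ⊕ U → InSpan L S

  InSpan-resp : ∀ {L S T} → S ≐ T → InSpan L S → InSpan L T
  InSpan-resp e (span-∅ z) = span-∅ (≐-trans (≐-sym e) z)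
  InSpan-resp e (span-∈ T m z) = span-∈ T m (≐-trans (≐-sym e) z)
  InSpan-resp e (span-⊕ T U p q z) = span-⊕ T U p q (≐-trans (≐-sym e) z)

  InSpan-mono : ∀ {L L′ S} → (∀ {T} → T ∈ L → T ∈ L′) → InSpan L S → InSpan L′ S
  InSpan-mono f (span-∅ z) = span-∅ z
  InSpan-mono f (span-∈ T m z) = span-∈ T (f m) z
  InSpan-mono f (span-⊕ T U p q z) = span-⊕ T U (InSpan-mono f p) (InSpan-mono f q) z

  InSpan-⊕ : ∀ {L S T} → InSpan L S → InSpan L T → InSpan L (S ⊕ T)
  InSpan-⊕ p q = span-⊕ _ _ p q λ _ _ → refl

  InSpan-⨁ : ∀ {L k} (F : Fin k → ESet n) → (∀ i → InSpan L (F i)) → InSpan L (λ u v → ⨁ λ i → F i u v)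
  InSpan-⨁ {k = zero} F _ = span-∅ λ _ _ → refl
  InSpan-⨁ {k = suc k} F h = span-⊕ (F zero) _ (h zero) (InSpan-⨁ (F ∘ suc) (h ∘ suc)) λ _ _ → refl

  infix 4 _∼[_]_

  record _∼[_]_ (S : ESet n) (L : List (ESet n)) (T : ESet n) : Set where
    constructor mk∼
    field get : InSpan L (S ⊕ T)
  open _∼[_]_ public

  ≐⇒∼ : ∀ {L S T} → S ≐ T → S ∼[ L ] T
  ≐⇒∼ {S = S} e = mk∼ (span-∅ λ u v → trans (cong (S u v xor_) (sym (e u v))) (xor-same (S u v)))

  ∼-sym : ∀ {L S T} → S ∼[ L ] T → T ∼[ L ] S
  ∼-sym {S = S} {T} (mk∼ p) = mk∼ (InSpan-resp (λ u v → xor-comm (S u v) (T u v)) p)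

  ∼-mono : ∀ {L L′ S T} → (∀ {W} → W ∈ L → W ∈ L′) → S ∼[ L ] T → S ∼[ L′ ] T
  ∼-mono f (mk∼ p) = mk∼ (InSpan-mono f p)

  ∼-⊕ : ∀ {L S S′ T T′} → S ∼[ L ] S′ → T ∼[ L ] T′ → S ⊕ T ∼[ L ] S′ ⊕ T′
  ∼-⊕ {S = S} {S′} {T} {T′} (mk∼ p) (mk∼ q) = mk∼ (InSpan-resp (⊕-interchange S S′ T T′) (InSpan-⊕ p q))

  ∼-⨁ : ∀ {L k} (F G : Fin k → ESet n) → (∀ i → F i ∼[ L ] G i) →
        (λ u v → ⨁ λ i → F i u v) ∼[ L ] (λ u v → ⨁ λ i → G i u v)
  ∼-⨁ {k = zero} F G _ = mk∼ (span-∅ λ _ _ → refl)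
  ∼-⨁ {k = suc k} F G F∼G = ∼-⊕ (F∼G zero) (∼-⨁ (F ∘ suc) (G ∘ suc) (F∼G ∘ suc))

  InSpan-∼ : ∀ {L S T} → InSpan L S → S ∼[ L ] T → InSpan L T
  InSpan-∼ {S = S} {T} p (mk∼ q) = InSpan-resp cancel (InSpan-⊕ p q)
    where
    cancel : S ⊕ (S ⊕ T) ≐ T
    cancel u v = trans (sym (xor-assoc (S u v) (S u v) (T u v))) (cong (_xor T u v) (xor-same (S u v)))

  ∼-trans : ∀ {L S T U} → S ∼[ L ] T → T ∼[ L ] U → S ∼[ L ] U
  ∼-trans {S = S} {T} {U} (mk∼ p) (mk∼ q) = mk∼ (InSpan-resp cancel (InSpan-⊕ p q))
    where
    cancel : (S ⊕ T) ⊕ (T ⊕ U) ≐ S ⊕ U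
    cancel u v = xor-cancel-middle (S u v) (T u v) (U u v)

module _ {n : ℕ} where

  IsCombinationOf : ∀ {k} → (Fin k → ESet n) → ESet n → Set
  IsCombinationOf B S = Σ (Fin _ → Bool) λ σ → combo σ B ≐ S

  Independent : ∀ {k} → (Fin k → ESet n) → Set
  Independent B = ∀ (σ : Fin _ → Bool) → (∀ u v → combo σ B u v ≡ false) → ∀ i → σ i ≡ false

  combo-⊕ : ∀ {k} (σ τ : Fin k → Bool) (B : Fin k → ESet n) →
            combo (λ i → σ i xor τ i) B ≐ combo σ B ⊕ combo τ B
  combo-⊕ {zero} σ τ B u v = refl
  combo-⊕ {suc k} σ τ B u v = trans
    (cong₂ _xor_ (∧-distribʳ-xor (B zero u v) (σ zero) (τ zero)) (combo-⊕ (σ ∘ suc) (τ ∘ suc) (B ∘ suc) u v))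
    (xor-interchange (σ zero ∧ B zero u v) (τ zero ∧ B zero u v) (combo (σ ∘ suc) (B ∘ suc) u v) (combo (τ ∘ suc) (B ∘ suc) u v))

  combo-none : ∀ {k} (B : Fin k → ESet n) → combo (λ _ → false) B ≐ ∅
  combo-none {zero} B u v = refl
  combo-none {suc k} B u v = combo-none (B ∘ suc) u v

  combination-⊕ : ∀ {k} {B : Fin k → ESet n} {S T} →
                  IsCombinationOf B S → IsCombinationOf B T → IsCombinationOf B (S ⊕ T)
  combination-⊕ {B = B} (σ , e) (τ , f) = (λ i → σ i xor τ i) , ≐-trans (combo-⊕ σ τ B) (⊕-cong e f)

  combination-resp : ∀ {k} {B : Fin k → ESet n} {S T} → S ≐ T → IsCombinationOf B S → IsCombinationOf B T
  combination-resp e (σ , f) = σ , ≐-trans f e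

  combination-there : ∀ {k} {B : Fin (suc k) → ESet n} {S} → IsCombinationOf (B ∘ suc) S → IsCombinationOf B S
  combination-there (σ , e) = false ◂ σ , e

  combination-here : ∀ {k} {B : Fin (suc k) → ESet n} → IsCombinationOf B (B zero)
  combination-here {B = B} = true ◂ (λ _ → false) , λ u v →
    trans (cong (B zero u v xor_) (combo-none (B ∘ suc) u v)) (xor-identityʳ _)

  _≐?_ : (S T : ESet n) → Dec (S ≐ T)
  S ≐? T with all? (λ u → all? (λ v → S u v ≟ᵇ T u v))
  ... | yes p = yes p
  ... | no ¬p = no ¬p

  isCombinationOf? : ∀ {k} (B : Fin k → ESet n) S → Dec (IsCombinationOf B S)
  isCombinationOf? {zero} B S with ∅ ≐? S
  ... | yes p = yes ((λ ()) , p)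
  ... | no ¬p = no λ (_ , e) → ¬p e
  isCombinationOf? {suc k} B S with isCombinationOf? (B ∘ suc) S | isCombinationOf? (B ∘ suc) (S ⊕ B zero)
  ... | yes (τ , e) | _ = yes (false ◂ τ , e)
  ... | no _ | yes (τ , e) = yes (true ◂ τ , λ u v → trans (cong (B zero u v xor_) (e u v)) (cancel (B zero u v) (S u v)))
    where
    open xor-∧-Solver
    cancel : ∀ a b → a xor (b xor a) ≡ b
    cancel = solve 2 (λ a b → a :+ (b :+ a) := b) refl
  ... | no ¬without | no ¬with = no ¬combination
    where
    ¬combination : ¬ IsCombinationOf B S
    ¬combination (σ , e) with σ zero | e
    ... | false | e′ = ¬without (σ ∘ suc , e′)
    ... | true | e′ = ¬with (σ ∘ suc , λ u v → trans (sym (cancel (B zero u v) _)) (cong (_xor B zero u v) (e′ u v)))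
      where
      open xor-∧-Solver
      cancel : ∀ a b → (a xor b) xor a ≡ b
      cancel = solve 2 (λ a b → (a :+ b) :+ a := b) refl

  load : List (ESet n) → Fin n → Fin n → ℕ
  load [] u v = 0
  load (S ∷ L) u v = ⟦ S u v ⟧ + load L u v

  count-lookup : ∀ (L : List (ESet n)) u v → count (λ i → lookup L i u v) ≡ load L u v
  count-lookup [] u v = refl
  count-lookup (S ∷ L) u v = cong (⟦ S u v ⟧ +_) (count-lookup L u v)

  record IndependentSubfamily (P : ESet n → Set) (L : List (ESet n)) : Set where
    field
      members     : List (ESet n)
      all-P       : All P members
      load-≤      : ∀ u v → load members u v ≤ load L u v
      spans       : ∀ {T} → T ∈ L → IsCombinationOf (lookup members) T
      independent : Independent (lookup members)

  independentSubfamily : ∀ {P : ESet n → Set} (L : List (ESet n)) → All P L → IndependentSubfamily P L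
  independentSubfamily [] [] = record
    { members = [] ; all-P = [] ; load-≤ = λ _ _ → z≤n ; spans = λ () ; independent = λ _ _ () }
  independentSubfamily (S ∷ L) (pS ∷ pL)
    with R ← independentSubfamily L pL
    with isCombinationOf? (lookup (IndependentSubfamily.members R)) S
  ... | yes S∈R = record
    { members = members
    ; all-P = all-P
    ; independent = independent
    ; load-≤ = λ u v → ≤-trans (load-≤ u v) (m≤n+m _ _)
    ; spans = λ { (here refl) → S∈R ; (there m) → spans m } }
    where open IndependentSubfamily R
  ... | no S∉R = record
    { members = S ∷ members
    ; all-P = pS ∷ all-P
    ; load-≤ = λ u v → +-monoʳ-≤ ⟦ S u v ⟧ (load-≤ u v)
    ; spans = λ { (here refl) → combination-here {B = lookup (S ∷ members)}
                ; (there m) → combination-there {B = lookup (S ∷ members)} (spans m) }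
    ; independent = independent′ }
    where
    open IndependentSubfamily R
    independent′ : Independent (lookup (S ∷ members))
    independent′ σ e i with σ zero in σ₀
    ... | true = ⊥-elim (S∉R (σ ∘ suc , λ u v → xor-false (e u v)))
      where
      xor-false : ∀ {a b} → a xor b ≡ false → b ≡ a
      xor-false {false} {false} _ = refl
      xor-false {true} {true} _ = refl
    independent′ σ e zero | false = σ₀
    independent′ σ e (suc i) | false = independent (σ ∘ suc) e i

  InSpan⇒combination : ∀ {L k} {B : Fin k → ESet n} → (∀ {T} → T ∈ L → IsCombinationOf B T) →
                       ∀ {S} → InSpan L S → IsCombinationOf B S
  InSpan⇒combination {B = B} _ (span-∅ e) = (λ _ → false) , ≐-trans (combo-none B) (≐-sym e)
  InSpan⇒combination f (span-∈ T m e) = combination-resp (≐-sym e) (f m)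
  InSpan⇒combination f (span-⊕ T U p q e) =
    combination-resp (≐-sym e) (combination-⊕ (InSpan⇒combination f p) (InSpan⇒combination f q))

  InSpan-combo : ∀ {L k} (σ : Fin k → Bool) (B : Fin k → ESet n) → (∀ i → InSpan L (B i)) → InSpan L (combo σ B)
  InSpan-combo {k = zero} σ B _ = span-∅ λ _ _ → refl
  InSpan-combo {k = suc k} σ B h = span-⊕ _ _ head (InSpan-combo (σ ∘ suc) (B ∘ suc) (h ∘ suc)) λ _ _ → refl
    where
    head : InSpan _ (λ u v → σ zero ∧ B zero u v)
    head with σ zero
    ... | true = InSpan-resp (λ _ _ → refl) (h zero)
    ... | false = span-∅ λ _ _ → refl

-- The owner of a pair of vertices in a tree-decomposition

module TreeFacts {n : ℕ} {adj : Adj n} (D : TreeDecomposition adj) where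
  open TreeDecomposition D

  Node : Set
  Node = Fin (suc m)

  A : Node → Fin n → Bool
  A = adhesion D

  data Descendant : Node → Node → Set where
    self : ∀ {t} → Descendant t t
    up   : ∀ {t} i → Descendant (par i) t → Descendant (suc i) t

  Descendant⇒≥ : ∀ {a t} → Descendant a t → toℕ t ≤ toℕ a
  Descendant⇒≥ self = ≤-refl
  Descendant⇒≥ (up i d) = ≤-trans (Descendant⇒≥ d) (≤-trans (par-ord i) (n≤1+n _))

  walk-first : ∀ {R : Node → Node → Set} {P : Node → Set} {a c} → Walk R P a c → P a
  walk-first (here p) = p
  walk-first (step p _ _) = p

  walk-stays-below : ∀ v {t a b} → (∀ i → t ≡ suc i → bag (par i) v ≡ false) →
                     Walk TAdj (λ s → bag s v ≡ true) a b → Descendant a t → Descendant b t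
  walk-stays-below v _ (here _) d = d
  walk-stays-below v notUp (step _ (inj₂ (i , refl , refl)) w) d = walk-stays-below v notUp w (up i d)
  walk-stays-below v notUp (step _ (inj₁ (i , refl , refl)) w) self
    with () ← trans (sym (walk-first w)) (notUp i refl)
  walk-stays-below v notUp (step _ (inj₁ (i , refl , refl)) w) (up .i d) = walk-stays-below v notUp w d

  non-adhesion-minimal : ∀ v t t′ → bag t v ≡ true → A t v ≡ false → bag t′ v ≡ true → toℕ t ≤ toℕ t′
  non-adhesion-minimal v t t′ bt at bt′ = Descendant⇒≥ (walk-stays-below v notUp (connected v t t′ bt bt′) self)
    where
    notUp : ∀ i → t ≡ suc i → bag (par i) v ≡ false
    notUp i refl with bag (par i) v in e
    ... | false = refl
    ... | true with () ← trans (sym at) (cong (_∧ true) bt)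

  owns : Node → Fin n → Fin n → Bool
  owns t x y = bag t x ∧ bag t y ∧ not (A t x ∧ A t y)

  adhesion⇒bag : ∀ t x → A t x ≡ true → bag t x ≡ true
  adhesion⇒bag (suc i) x e = ∧-trueˡ e

  adhesion⇒bag-parent : ∀ i x → A (suc i) x ≡ true → bag (par i) x ≡ true
  adhesion⇒bag-parent i x e = ∧-trueʳ {bag (suc i) x} e

  owns⇒bagˡ : ∀ t x y → owns t x y ≡ true → bag t x ≡ true
  owns⇒bagˡ t x y = ∧-trueˡ

  owns⇒bagʳ : ∀ t x y → owns t x y ≡ true → bag t y ≡ true
  owns⇒bagʳ t x y o = ∧-trueˡ (∧-trueʳ {bag t x} o)

  owns⇒¬adhesion : ∀ t x y → owns t x y ≡ true → (A t x ∧ A t y) ≡ false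
  owns⇒¬adhesion t x y o with A t x ∧ A t y | ∧-trueʳ {bag t y} (∧-trueʳ {bag t x} o)
  ... | false | _ = refl

  owns-sym : ∀ t x y → owns t x y ≡ owns t y x
  owns-sym t x y = trans (sym (∧-assoc (bag t x) (bag t y) _))
                         (trans (cong₂ _∧_ (∧-comm (bag t x) (bag t y)) (cong not (∧-comm (A t x) (A t y))))
                                (∧-assoc (bag t y) (bag t x) _))

  owner-unique : ∀ x y t t′ → owns t x y ≡ true → owns t′ x y ≡ true → t ≡ t′
  owner-unique x y t t′ o o′ = toℕ-injective (≤-antisym (minimal t t′ o o′) (minimal t′ t o′ o))
    where
    minimal : ∀ t t′ → owns t x y ≡ true → owns t′ x y ≡ true → toℕ t ≤ toℕ t′
    minimal t t′ o o′ with bag t x in bx | bag t y in by | A t x in ax | A t y in ay | bag t′ x in bx′ | bag t′ y in by′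
    minimal t t′ () o′ | false | _ | _ | _ | _ | _
    minimal t t′ () o′ | true | false | _ | _ | _ | _
    minimal t t′ o () | true | true | _ | _ | false | _
    minimal t t′ o () | true | true | _ | _ | true | false
    minimal t t′ () o′ | true | true | true | true | true | true
    minimal t t′ o o′ | true | true | false | _ | true | true = non-adhesion-minimal x t t′ bx ax bx′
    minimal t t′ o o′ | true | true | true | false | true | true = non-adhesion-minimal y t t′ by ay by′

  -- Walk towards the root while both vertices stay in the adhesion; the root has empty adhesion.
  owner-exists : ∀ x y t → bag t x ≡ true → bag t y ≡ true → ∃ λ t′ → owns t′ x y ≡ true
  owner-exists x y t = go (suc (toℕ t)) t ≤-refl
    where
    go : ∀ k t → toℕ t < k → bag t x ≡ true → bag t y ≡ true → ∃ λ t′ → owns t′ x y ≡ true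
    go (suc k) t t<k bx by with A t x ∧ A t y in axy
    ... | false = t , trans (cong₂ (λ p q → p ∧ q ∧ not (A t x ∧ A t y)) bx by) (cong not axy)
    go (suc k) (suc i) (s≤s t<k) bx by | true =
      go k (par i) (≤-<-trans (par-ord i) t<k)
         (∧-trueʳ {bag (suc i) x} (∧-trueˡ axy)) (∧-trueʳ {bag (suc i) y} (∧-trueʳ {A (suc i) x} axy))

  parent-unique : ∀ s t t′ → isChildOf D s t ≡ true → isChildOf D s t′ ≡ true → t ≡ t′
  parent-unique (suc i) t t′ c c′ = trans (sym (==⇒≡ c)) (==⇒≡ c′)

-- Joins: edge sets whose odd-degree vertices are exactly two given vertices

edge : ∀ {n} → Fin n → Fin n → ESet n
edge x y u v = ((u == x) ∧ (v == y)) xor ((u == y) ∧ (v == x))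

edge-sym : ∀ {n} (x y u v : Fin n) → edge x y u v ≡ edge x y v u
edge-sym x y u v = trans (xor-comm ((u == x) ∧ (v == y)) _) (cong₂ _xor_ (∧-comm (u == y) (v == x)) (∧-comm (u == x) (v == y)))

edge-irrefl : ∀ {n} (x y u : Fin n) → edge x y u u ≡ false
edge-irrefl x y u = trans (cong (((u == x) ∧ (u == y)) xor_) (∧-comm (u == y) (u == x))) (xor-same ((u == x) ∧ (u == y)))

edge-true : ∀ {n} {x y u v : Fin n} → edge x y u v ≡ true → (u ≡ x × v ≡ y) ⊎ (u ≡ y × v ≡ x)
edge-true {x = x} {y} {u} {v} e with xor-true {(u == x) ∧ (v == y)} e
... | inj₁ p = inj₁ (==⇒≡ (∧-trueˡ p) , ==⇒≡ (∧-trueʳ {u == x} p))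
... | inj₂ p = inj₂ (==⇒≡ (∧-trueˡ p) , ==⇒≡ (∧-trueʳ {u == y} p))

edge-boundary : ∀ {n} (x y v : Fin n) → ⨁ (edge x y v) ≡ (v == x) xor (v == y)
edge-boundary x y v = begin
  ⨁ (λ w → ((v == x) ∧ (w == y)) xor ((v == y) ∧ (w == x)))
    ≡⟨ ⨁-distrib-xor (λ w → (v == x) ∧ (w == y)) (λ w → (v == y) ∧ (w == x)) ⟩
  ⨁ (λ w → (v == x) ∧ (w == y)) xor ⨁ (λ w → (v == y) ∧ (w == x))
    ≡⟨ cong₂ _xor_ (trans (∧-distribˡ-⨁ (v == x) (λ w → w == y)) (cong ((v == x) ∧_) (ends y)))
                   (trans (∧-distribˡ-⨁ (v == y) (λ w → w == x)) (cong ((v == y) ∧_) (ends x))) ⟩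
  ((v == x) ∧ true) xor ((v == y) ∧ true)
    ≡⟨ cong₂ _xor_ (∧-identityʳ (v == x)) (∧-identityʳ (v == y)) ⟩
  (v == x) xor (v == y) ∎
  where
  open ≡-Reasoning
  ends : ∀ z → ⨁ (λ w → w == z) ≡ true
  ends z = trans (⨁-cong λ w → ==-sym w z) (⨁-== z)

hasEdge-sym : ∀ {n} (u v : Fin n) xs → hasEdge u v xs ≡ hasEdge v u xs
hasEdge-sym u v [] = refl
hasEdge-sym u v (a ∷ []) = refl
hasEdge-sym u v (a ∷ b ∷ r) = begin
  X ∨ (Y ∨ hasEdge u v (b ∷ r)) ≡⟨ cong (λ z → X ∨ (Y ∨ z)) (hasEdge-sym u v (b ∷ r)) ⟩
  X ∨ (Y ∨ hasEdge v u (b ∷ r)) ≡⟨ swap X Y _ ⟩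
  Y ∨ (X ∨ hasEdge v u (b ∷ r)) ∎
  where
  open ≡-Reasoning
  X Y : Bool
  X = (a == u) ∧ (b == v)
  Y = (a == v) ∧ (b == u)
  swap : ∀ p q r → p ∨ (q ∨ r) ≡ q ∨ (p ∨ r)
  swap false q r = refl
  swap true false r = refl
  swap true true r = refl

hasEdge-∷ : ∀ {n} (u v a b : Fin n) r → hasEdge u v (a ∷ b ∷ r) ≡ true →
            (a ≡ u × b ≡ v) ⊎ (a ≡ v × b ≡ u) ⊎ hasEdge u v (b ∷ r) ≡ true
hasEdge-∷ u v a b r h with (a == u) ∧ (b == v) in e₁
... | true = inj₁ (==⇒≡ (∧-trueˡ e₁) , ==⇒≡ (∧-trueʳ {a == u} e₁))
... | false with (a == v) ∧ (b == u) in e₂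
... | true = inj₂ (inj₁ (==⇒≡ (∧-trueˡ e₂) , ==⇒≡ (∧-trueʳ {a == v} e₂)))
... | false = inj₂ (inj₂ h)

hasEdge-∈ : ∀ {n} (u v : Fin n) xs → hasEdge u v xs ≡ true → u ∈ xs
hasEdge-∈ u v [] ()
hasEdge-∈ u v (a ∷ []) ()
hasEdge-∈ u v (a ∷ b ∷ r) h =
  [_,_] (λ p → here (sym (proj₁ p)))
        ([_,_] (λ p → there (here (sym (proj₂ p)))) (λ h′ → there (hasEdge-∈ u v (b ∷ r) h′)))
        (hasEdge-∷ u v a b r h)

hasEdge-path : ∀ {n} (v w a b : Fin n) r → ¬ a ∈ b ∷ r →
               hasEdge v w (a ∷ b ∷ r) ≡ edge a b v w xor hasEdge v w (b ∷ r)
hasEdge-path v w a b r a∉ = begin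
  X ∨ (Y ∨ R)       ≡⟨ ∨≡xor-disjoint X Y R X∧Y X∧R Y∧R ⟩
  (X xor Y) xor R   ≡⟨ cong (_xor R) (cong₂ _xor_ (cong₂ _∧_ (==-sym a v) (==-sym b w))
                                                   (trans (∧-comm (a == w) (b == v)) (cong₂ _∧_ (==-sym b v) (==-sym a w)))) ⟩
  edge a b v w xor R ∎
  where
  open ≡-Reasoning
  X Y R : Bool
  X = (a == v) ∧ (b == w)
  Y = (a == w) ∧ (b == v)
  R = hasEdge v w (b ∷ r)
  X∧Y : X ≡ true → Y ≡ true → ⊥
  X∧Y x y = a∉ (here (trans (==⇒≡ {u = a} {w} (∧-trueˡ y)) (sym (==⇒≡ {u = b} {w} (∧-trueʳ {a == v} x)))))
  X∧R : X ≡ true → R ≡ true → ⊥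
  X∧R x h = a∉ (subst (_∈ b ∷ r) (sym (==⇒≡ {u = a} {v} (∧-trueˡ x))) (hasEdge-∈ v w (b ∷ r) h))
  Y∧R : Y ≡ true → R ≡ true → ⊥
  Y∧R y h = a∉ (subst (_∈ b ∷ r) (sym (==⇒≡ {u = a} {w} (∧-trueˡ y)))
                      (hasEdge-∈ w v (b ∷ r) (trans (hasEdge-sym w v (b ∷ r)) h)))

module Joins {n : ℕ} {adj : Adj n} (G : IsGraph adj) where

  IsJoin : Fin n → Fin n → ESet n → Set
  IsJoin x y Z = IsEdgeSubset adj Z × (∀ v → ⨁ (Z v) ≡ (v == x) xor (v == y))

  IsCycle : ESet n → Set
  IsCycle Z = IsEdgeSubset adj Z × Even Z

  edge-isJoin : ∀ x y → adj x y ≡ true → IsJoin x y (edge x y)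
  edge-isJoin x y xy = record { sym = edge-sym x y ; irrefl = edge-irrefl x y ; sub = sub } , edge-boundary x y
    where
    sub : ∀ u v → edge x y u v ≡ true → adj u v ≡ true
    sub u v e with edge-true {x = x} {y} {u} {v} e
    ... | inj₁ (refl , refl) = xy
    ... | inj₂ (refl , refl) = trans (IsGraph.sym G _ _) xy

  walk-head : ∀ {a c xs} → VWalk adj a c xs → ∃ λ r → xs ≡ a ∷ r
  walk-head (single _) = _ , refl
  walk-head (cons _ _) = _ , refl

  walk-edges : ∀ {a c xs} → VWalk adj a c xs → ∀ u v → hasEdge u v xs ≡ true → adj u v ≡ true
  walk-edges {a} (cons {w = b} ab W) u v h with walk-head W
  ... | r , refl with hasEdge-∷ u v a b r h
  ... | inj₁ (refl , refl) = ab
  ... | inj₂ (inj₁ (refl , refl)) = trans (IsGraph.sym G u v) ab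
  ... | inj₂ (inj₂ h′) = walk-edges W u v h′

  path-boundary : ∀ {a c xs} → VWalk adj a c xs → Unique xs → ∀ v → ⨁ (λ w → hasEdge v w xs) ≡ (v == a) xor (v == c)
  path-boundary (single a) _ v = trans (⨁-false {n} _ λ _ → refl) (sym (xor-same (v == a)))
  path-boundary {a} {c} (cons {w = b} _ W) (a∉ ∷ unique) v with walk-head W
  ... | r , refl = begin
    ⨁ (λ w → hasEdge v w (a ∷ b ∷ r))                      ≡⟨ ⨁-cong (λ w → hasEdge-path v w a b r (AllP.All¬⇒¬Any a∉)) ⟩
    ⨁ (λ w → edge a b v w xor hasEdge v w (b ∷ r))         ≡⟨ ⨁-distrib-xor (edge a b v) (λ w → hasEdge v w (b ∷ r)) ⟩
    ⨁ (edge a b v) xor ⨁ (λ w → hasEdge v w (b ∷ r))       ≡⟨ cong₂ _xor_ (edge-boundary a b v) (path-boundary W unique v) ⟩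
    ((v == a) xor (v == b)) xor ((v == b) xor (v == c))    ≡⟨ xor-cancel-middle (v == a) (v == b) (v == c) ⟩
    (v == a) xor (v == c)                                  ∎
    where open ≡-Reasoning

  path-isJoin : ∀ x y xs → IsPath adj x y xs → IsJoin x y (λ u v → hasEdge u v xs)
  path-isJoin x y xs (W , unique) =
    record { sym = λ u v → hasEdge-sym u v xs ; irrefl = irrefl ; sub = walk-edges W } , path-boundary W unique
    where
    irrefl : ∀ u → hasEdge u u xs ≡ false
    irrefl u with hasEdge u u xs in h
    ... | false = refl
    ... | true = ⊥-elim (false≢true (trans (sym (IsGraph.irrefl G u)) (walk-edges W u u h)))

  isJoin-⊕ : ∀ {x y Z Z′} → IsJoin x y Z → IsJoin x y Z′ → IsCycle (Z ⊕ Z′)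
  isJoin-⊕ {x} {y} {Z} {Z′} (Z⊆G , ∂Z) (Z′⊆G , ∂Z′) =
    record { sym = λ u v → cong₂ _xor_ (IsEdgeSubset.sym Z⊆G u v) (IsEdgeSubset.sym Z′⊆G u v)
           ; irrefl = λ u → cong₂ _xor_ (IsEdgeSubset.irrefl Z⊆G u) (IsEdgeSubset.irrefl Z′⊆G u)
           ; sub = sub }
    , λ v → trans (⨁-distrib-xor (Z v) (Z′ v)) (trans (cong₂ _xor_ (∂Z v) (∂Z′ v)) (xor-same ((v == x) xor (v == y))))
    where
    sub : ∀ u v → Z u v xor Z′ u v ≡ true → adj u v ≡ true
    sub u v h with Z u v in e
    ... | true = IsEdgeSubset.sub Z⊆G u v e
    ... | false = IsEdgeSubset.sub Z′⊆G u v h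

module _ {n : ℕ} where

  oriented : ESet n → Fin n → Fin n → Bool
  oriented C x y = (x ≺ y) ∧ C x y

  substitute : ESet n → (Fin n → Fin n → ESet n) → ESet n
  substitute C Φ u v = ⨁ λ x → ⨁ λ y → oriented C x y ∧ Φ x y u v

  substitute-cong : ∀ {C C′} (Φ : Fin n → Fin n → ESet n) → C ≐ C′ → substitute C Φ ≐ substitute C′ Φ
  substitute-cong Φ e u v = ⨁-cong λ x → ⨁-cong λ y → cong (λ c → ((x ≺ y) ∧ c) ∧ Φ x y u v) (e x y)

  substitute-⊕ : ∀ C C′ (Φ : Fin n → Fin n → ESet n) → substitute (C ⊕ C′) Φ ≐ substitute C Φ ⊕ substitute C′ Φ
  substitute-⊕ C C′ Φ u v = trans (⨁-cong λ x → trans (⨁-cong λ y → distrib (x ≺ y) (C x y) (C′ x y) (Φ x y u v))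
                                                       (⨁-distrib-xor {n} _ _))
                                  (⨁-distrib-xor {n} _ _)
    where
    distrib : ∀ l c c′ p → (l ∧ (c xor c′)) ∧ p ≡ ((l ∧ c) ∧ p) xor ((l ∧ c′) ∧ p)
    distrib l c c′ p = trans (cong (_∧ p) (∧-distribˡ-xor l c c′)) (∧-distribʳ-xor p (l ∧ c) (l ∧ c′))

  substitute-∧ : ∀ b C (Φ : Fin n → Fin n → ESet n) → substitute (λ x y → b ∧ C x y) Φ ≐ (λ u v → b ∧ substitute C Φ u v)
  substitute-∧ b C Φ u v = trans (⨁-cong λ x → trans (⨁-cong λ y → reassoc (x ≺ y) (C x y) (Φ x y u v))
                                                       (∧-distribˡ-⨁ {n} b _))
                                 (∧-distribˡ-⨁ {n} b _)
    where
    reassoc : ∀ l c p → (l ∧ (b ∧ c)) ∧ p ≡ b ∧ ((l ∧ c) ∧ p)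
    reassoc l c p = trans (cong (_∧ p) (trans (cong (l ∧_) (∧-comm b c)) (sym (∧-assoc l c b))))
                          (trans (∧-assoc (l ∧ c) b p) (trans (cong ((l ∧ c) ∧_) (∧-comm b p))
                          (trans (sym (∧-assoc (l ∧ c) p b)) (∧-comm ((l ∧ c) ∧ p) b))))

  substitute-∅ : ∀ {C} (Φ : Fin n → Fin n → ESet n) → C ≐ ∅ → substitute C Φ ≐ ∅
  substitute-∅ Φ e u v = trans (substitute-cong Φ e u v)
                               (⨁-false {n} _ λ x → ⨁-false {n} _ λ y → cong (_∧ Φ x y u v) (∧-zeroʳ (x ≺ y)))

  substitute-⨁ : ∀ {k} (C : Fin k → ESet n) (Φ : Fin n → Fin n → ESet n) →
                 substitute (λ x y → ⨁ λ s → C s x y) Φ ≐ (λ u v → ⨁ λ s → substitute (C s) Φ u v)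
  substitute-⨁ {zero} C Φ = substitute-∅ Φ λ _ _ → refl
  substitute-⨁ {suc k} C Φ u v = trans (substitute-⊕ (C zero) (λ x y → ⨁ λ s → C (suc s) x y) Φ u v)
                                       (cong (substitute (C zero) Φ u v xor_) (substitute-⨁ (C ∘ suc) Φ u v))

  substitute-combo : ∀ {k} (σ : Fin k → Bool) (B : Fin k → ESet n) (Φ : Fin n → Fin n → ESet n) →
                     substitute (combo σ B) Φ ≐ combo σ (λ i → substitute (B i) Φ)
  substitute-combo {zero} σ B Φ = substitute-∅ Φ λ _ _ → refl
  substitute-combo {suc k} σ B Φ u v =
    trans (substitute-⊕ (λ x y → σ zero ∧ B zero x y) (combo (σ ∘ suc) (B ∘ suc)) Φ u v)
          (cong₂ _xor_ (substitute-∧ (σ zero) (B zero) Φ u v) (substitute-combo (σ ∘ suc) (B ∘ suc) Φ u v))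

  substitute-∼ : ∀ {L} C (Φ Ψ : Fin n → Fin n → ESet n) →
                 (∀ x y → oriented C x y ≡ true → Φ x y ∼[ L ] Ψ x y) → substitute C Φ ∼[ L ] substitute C Ψ
  substitute-∼ {L} C Φ Ψ Φ∼Ψ = mk∼ (InSpan-resp split (InSpan-⨁ _ λ x → InSpan-⨁ _ λ y → term x y))
    where
    term : ∀ x y → InSpan L (λ u v → oriented C x y ∧ (Φ x y u v xor Ψ x y u v))
    term x y with oriented C x y in o
    ... | false = span-∅ λ _ _ → refl
    ... | true = get (Φ∼Ψ x y o)
    split : (λ u v → ⨁ λ x → ⨁ λ y → oriented C x y ∧ (Φ x y u v xor Ψ x y u v)) ≐ substitute C Φ ⊕ substitute C Ψ
    split u v = trans (⨁-cong λ x → trans (⨁-cong λ y → ∧-distribˡ-xor (oriented C x y) (Φ x y u v) (Ψ x y u v))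
                                          (⨁-distrib-xor {n} _ _))
                      (⨁-distrib-xor {n} _ _)

  substitute-isEdgeSubset : ∀ {adj : Adj n} C (Φ : Fin n → Fin n → ESet n) →
    (∀ x y → oriented C x y ≡ true → IsEdgeSubset adj (Φ x y)) → IsEdgeSubset adj (substitute C Φ)
  substitute-isEdgeSubset {adj} C Φ Φ⊆G = record
    { sym = λ u v → ⨁-cong λ x → ⨁-cong λ y → termwise x y λ o → IsEdgeSubset.sym (Φ⊆G x y o) u v
    ; irrefl = λ u → ⨁-false {n} _ λ x → ⨁-false {n} _ λ y →
                     trans (termwise x y λ o → IsEdgeSubset.irrefl (Φ⊆G x y o) u) (∧-zeroʳ (oriented C x y))
    ; sub = sub }
    where
    termwise : ∀ x y {p q} → (oriented C x y ≡ true → p ≡ q) → oriented C x y ∧ p ≡ oriented C x y ∧ q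
    termwise x y h with oriented C x y
    ... | false = refl
    ... | true = h refl
    sub : ∀ u v → substitute C Φ u v ≡ true → adj u v ≡ true
    sub u v e with x , e′ ← ⨁-true _ e with y , e″ ← ⨁-true _ e′ =
      IsEdgeSubset.sub (Φ⊆G x y (∧-trueˡ e″)) u v (∧-trueʳ {oriented C x y} e″)

  oriented-pair : ∀ C → (∀ x y → C x y ≡ C y x) → (∀ x → C x x ≡ false) →
                  ∀ x y → oriented C x y xor oriented C y x ≡ C x y
  oriented-pair C symm irrefl x y = begin
    ((x ≺ y) ∧ C x y) xor ((y ≺ x) ∧ C y x) ≡⟨ cong (λ c → ((x ≺ y) ∧ C x y) xor ((y ≺ x) ∧ c)) (symm y x) ⟩
    ((x ≺ y) ∧ C x y) xor ((y ≺ x) ∧ C x y) ≡⟨ sym (∧-distribʳ-xor (C x y) (x ≺ y) (y ≺ x)) ⟩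
    ((x ≺ y) xor (y ≺ x)) ∧ C x y           ≡⟨ cong (_∧ C x y) (≺-xor-≻ x y) ⟩
    not (x == y) ∧ C x y                    ≡⟨ diagonal (x == y) refl ⟩
    C x y                                   ∎
    where
    open ≡-Reasoning
    diagonal : ∀ b → (x == y) ≡ b → not b ∧ C x y ≡ C x y
    diagonal false _ = refl
    diagonal true e with refl ← ==⇒≡ {u = x} {y} e = sym (irrefl x)

  substitute-edge : ∀ C → (∀ x y → C x y ≡ C y x) → (∀ x → C x x ≡ false) → substitute C edge ≐ C
  substitute-edge C symm irrefl u v = begin
    ⨁ (λ x → ⨁ λ y → oriented C x y ∧ (((u == x) ∧ (v == y)) xor ((u == y) ∧ (v == x))))
      ≡⟨ trans (⨁-cong λ x → trans (⨁-cong λ y → ∧-distribˡ-xor (oriented C x y) _ _) (⨁-distrib-xor {n} _ _))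
               (⨁-distrib-xor {n} _ _) ⟩
    ⨁ (λ x → ⨁ λ y → oriented C x y ∧ ((u == x) ∧ (v == y))) xor ⨁ (λ x → ⨁ λ y → oriented C x y ∧ ((u == y) ∧ (v == x)))
      ≡⟨ cong₂ _xor_ (pick u v) (trans (⨁-cong λ x → ⨁-cong λ y → cong (oriented C x y ∧_) (∧-comm (u == y) (v == x)))
                                       (pick v u)) ⟩
    oriented C u v xor oriented C v u
      ≡⟨ oriented-pair C symm irrefl u v ⟩
    C u v ∎
    where
    open ≡-Reasoning
    pick : ∀ u v → ⨁ (λ x → ⨁ λ y → oriented C x y ∧ ((u == x) ∧ (v == y))) ≡ oriented C u v
    pick u v = begin
      ⨁ (λ x → ⨁ λ y → oriented C x y ∧ ((u == x) ∧ (v == y)))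
        ≡⟨ ⨁-cong (λ x → trans (⨁-cong λ y → swap (oriented C x y) (u == x) (v == y)) (∧-distribˡ-⨁ {n} (u == x) _)) ⟩
      ⨁ (λ x → (u == x) ∧ ⨁ λ y → oriented C x y ∧ (v == y))
        ≡⟨ ⨁-select u (λ x → ⨁ λ y → oriented C x y ∧ (v == y)) ⟩
      ⨁ (λ y → oriented C u y ∧ (v == y))
        ≡⟨ ⨁-selectʳ v (oriented C u) ⟩
      oriented C u v ∎
      where
      swap : ∀ b p q → b ∧ (p ∧ q) ≡ p ∧ (b ∧ q)
      swap b p q = trans (sym (∧-assoc b p q)) (trans (cong (_∧ q) (∧-comm b p)) (∧-assoc p b q))

  substitute-boundary : ∀ C (Φ : Fin n → Fin n → ESet n) → (∀ x y → C x y ≡ C y x) → (∀ x → C x x ≡ false) →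
    (∀ x y → oriented C x y ≡ true → ∀ v → ⨁ (Φ x y v) ≡ (v == x) xor (v == y)) →
    ∀ v → ⨁ (substitute C Φ v) ≡ ⨁ (C v)
  substitute-boundary C Φ symm irrefl ∂Φ v = begin
    ⨁ (λ w → ⨁ λ x → ⨁ λ y → b x y ∧ Φ x y v w)
      ≡⟨ trans (⨁-comm {n} {n} (λ w x → ⨁ λ y → b x y ∧ Φ x y v w))
               (⨁-cong λ x → ⨁-comm {n} {n} (λ w y → b x y ∧ Φ x y v w)) ⟩
    ⨁ (λ x → ⨁ λ y → ⨁ λ w → b x y ∧ Φ x y v w)
      ≡⟨ ⨁-cong (λ x → ⨁-cong λ y → trans (∧-distribˡ-⨁ {n} (b x y) _) (endpoints x y)) ⟩
    ⨁ (λ x → ⨁ λ y → (b x y ∧ (v == x)) xor (b x y ∧ (v == y)))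
      ≡⟨ trans (⨁-cong λ x → ⨁-distrib-xor (λ y → b x y ∧ (v == x)) (λ y → b x y ∧ (v == y)))
               (⨁-distrib-xor (λ x → ⨁ λ y → b x y ∧ (v == x)) (λ x → ⨁ λ y → b x y ∧ (v == y))) ⟩
    ⨁ (λ x → ⨁ λ y → b x y ∧ (v == x)) xor ⨁ (λ x → ⨁ λ y → b x y ∧ (v == y))
      ≡⟨ cong₂ _xor_ outgoing incoming ⟩
    ⨁ (λ y → b v y) xor ⨁ (λ x → b x v)
      ≡⟨ sym (⨁-distrib-xor (b v) (λ x → b x v)) ⟩
    ⨁ (λ y → b v y xor b y v)
      ≡⟨ ⨁-cong (oriented-pair C symm irrefl v) ⟩
    ⨁ (C v) ∎
    where
    open ≡-Reasoning
    b : Fin n → Fin n → Bool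
    b = oriented C
    endpoints : ∀ x y → b x y ∧ ⨁ (λ w → Φ x y v w) ≡ (b x y ∧ (v == x)) xor (b x y ∧ (v == y))
    endpoints x y with b x y in o
    ... | false = refl
    ... | true = ∂Φ x y o v
    outgoing : ⨁ (λ x → ⨁ λ y → b x y ∧ (v == x)) ≡ ⨁ (λ y → b v y)
    outgoing = trans (⨁-cong λ x → trans (⨁-cong λ y → ∧-comm (b x y) (v == x)) (∧-distribˡ-⨁ {n} (v == x) _))
                     (⨁-select v (λ x → ⨁ (b x)))
    incoming : ⨁ (λ x → ⨁ λ y → b x y ∧ (v == y)) ≡ ⨁ (λ x → b x v)
    incoming = trans (⨁-comm {n} {n} (λ x y → b x y ∧ (v == y)))
                     (trans (⨁-cong λ y → trans (⨁-cong λ x → ∧-comm (b x y) (v == y))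
                                                (trans (∧-distribˡ-⨁ {n} (v == y) _) (∧-comm (v == y) _)))
                            (⨁-selectʳ v (λ y → ⨁ λ x → b x y)))

selected : ∀ {A : Set} {k} → (Fin k → Bool) → (Fin k → A) → List A
selected {k = zero} p f = []
selected {k = suc k} p f = if p zero then f zero ∷ selected (p ∘ suc) (f ∘ suc) else selected (p ∘ suc) (f ∘ suc)

∈-selected : ∀ {A : Set} {k} (p : Fin k → Bool) (f : Fin k → A) i → p i ≡ true → f i ∈ selected p f
∈-selected p f zero pᵢ rewrite pᵢ = here refl
∈-selected p f (suc i) pᵢ with p zero
... | true = there (∈-selected (p ∘ suc) (f ∘ suc) i pᵢ)
... | false = ∈-selected (p ∘ suc) (f ∘ suc) i pᵢ

all-selected : ∀ {A : Set} {Q : A → Set} {k} (p : Fin k → Bool) (f : Fin k → A) →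
               (∀ i → p i ≡ true → Q (f i)) → All Q (selected p f)
all-selected {k = zero} p f _ = []
all-selected {k = suc k} p f h with p zero in p₀
... | true = h zero p₀ ∷ all-selected (p ∘ suc) (f ∘ suc) (h ∘ suc)
... | false = all-selected (p ∘ suc) (f ∘ suc) (h ∘ suc)

∈-concat-tabulate : ∀ {A : Set} {k} (F : Fin k → List A) i {x} → x ∈ F i → x ∈ concat (tabulate F)
∈-concat-tabulate F i x∈ = ∈-concat⁺′ x∈ (∈-tabulate⁺ i)

all-concat-tabulate : ∀ {A : Set} {Q : A → Set} {k} (F : Fin k → List A) → (∀ i → All Q (F i)) → All Q (concat (tabulate F))
all-concat-tabulate F h = AllP.concat⁺ (AllP.tabulate⁺ h)

module _ {n : ℕ} where

  differences : List (ESet n) → List (ESet n)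
  differences (Z ∷ Z′ ∷ Zs) = Z ⊕ Z′ ∷ differences (Z′ ∷ Zs)
  differences _ = []

  differences-∼-head : ∀ {Z Z₀} Zs → Z ∈ Z₀ ∷ Zs → Z ∼[ differences (Z₀ ∷ Zs) ] Z₀
  differences-∼-head _ (here refl) = ≐⇒∼ λ _ _ → refl
  differences-∼-head {Z₀ = Z₀} (Z₁ ∷ Zs) (there m) =
    ∼-trans (∼-mono there (differences-∼-head Zs m)) (mk∼ (span-∈ (Z₀ ⊕ Z₁) (here refl) λ u v → xor-comm (Z₁ u v) (Z₀ u v)))

  differences-∼ : ∀ {Z Z′} Zs → Z ∈ Zs → Z′ ∈ Zs → Z ∼[ differences Zs ] Z′
  differences-∼ (_ ∷ Zs) m m′ = ∼-trans (differences-∼-head Zs m) (∼-sym (differences-∼-head Zs m′))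

  all-differences : ∀ {Q R : ESet n → Set} → (∀ {Z Z′} → Q Z → Q Z′ → R (Z ⊕ Z′)) →
                    ∀ {Zs} → All Q Zs → All R (differences Zs)
  all-differences close (qZ ∷ qZ′ ∷ qZs) = close qZ qZ′ ∷ all-differences close (qZ′ ∷ qZs)
  all-differences close [] = []
  all-differences close (_ ∷ []) = []

  load-++ : ∀ (L L′ : List (ESet n)) u v → load (L ++ L′) u v ≡ load L u v + load L′ u v
  load-++ [] L′ u v = refl
  load-++ (S ∷ L) L′ u v = trans (cong (⟦ S u v ⟧ +_) (load-++ L L′ u v)) (sym (+-assoc ⟦ S u v ⟧ _ _))

  load-tabulate : ∀ {k} (f : Fin k → ESet n) u v → load (tabulate f) u v ≡ sum (λ i → ⟦ f i u v ⟧)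
  load-tabulate {zero} f u v = refl
  load-tabulate {suc k} f u v = cong (⟦ f zero u v ⟧ +_) (load-tabulate (f ∘ suc) u v)

  load-concat-tabulate : ∀ {k} (F : Fin k → List (ESet n)) u v → load (concat (tabulate F)) u v ≡ sum (λ i → load (F i) u v)
  load-concat-tabulate {zero} F u v = refl
  load-concat-tabulate {suc k} F u v =
    trans (load-++ (F zero) _ u v) (cong (load (F zero) u v +_) (load-concat-tabulate (F ∘ suc) u v))

  load-selected : ∀ {k} (p : Fin k → Bool) (f : Fin k → ESet n) u v →
                  load (selected p f) u v ≡ sum (λ i → ⟦ p i ∧ f i u v ⟧)
  load-selected {zero} p f u v = refl
  load-selected {suc k} p f u v with p zero
  ... | true = cong (⟦ f zero u v ⟧ +_) (load-selected (p ∘ suc) (f ∘ suc) u v)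
  ... | false = load-selected (p ∘ suc) (f ∘ suc) u v

  -- Every element other than the first is counted in two consecutive sums.
  load-differences-∷ : ∀ Z Zs u v → load (differences (Z ∷ Zs)) u v ≤ ⟦ Z u v ⟧ + 2 * load Zs u v
  load-differences-∷ Z [] u v = z≤n
  load-differences-∷ Z (Z′ ∷ Zs) u v = begin
    ⟦ Z u v xor Z′ u v ⟧ + load (differences (Z′ ∷ Zs)) u v
      ≤⟨ +-mono-≤ (⟦xor⟧≤ (Z u v) (Z′ u v)) (load-differences-∷ Z′ Zs u v) ⟩
    (⟦ Z u v ⟧ + ⟦ Z′ u v ⟧) + (⟦ Z′ u v ⟧ + 2 * load Zs u v)
      ≡⟨ regroup ⟦ Z u v ⟧ ⟦ Z′ u v ⟧ (load Zs u v) ⟩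
    ⟦ Z u v ⟧ + 2 * (⟦ Z′ u v ⟧ + load Zs u v) ∎
    where
    open ≤-Reasoning
    regroup : ∀ a b c → (a + b) + (b + 2 * c) ≡ a + 2 * (b + c)
    regroup = solve-∀

  load-differences : ∀ Zs u v → load (differences Zs) u v ≤ 2 * load Zs u v
  load-differences [] u v = z≤n
  load-differences (Z ∷ Zs) u v =
    ≤-trans (load-differences-∷ Z Zs u v)
            (≤-trans (+-monoˡ-≤ _ (m≤n*m ⟦ Z u v ⟧ 2)) (≤-reflexive (sym (*-distribˡ-+ 2 ⟦ Z u v ⟧ _))))

firstTrue : ∀ {k} → (Fin (suc k) → Bool) → Fin (suc k)
firstTrue {zero} f = zero
firstTrue {suc k} f = if f zero then zero else suc (firstTrue (f ∘ suc))

firstTrue-true : ∀ {k} (f : Fin (suc k) → Bool) → anyFin f ≡ true → f (firstTrue f) ≡ true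
firstTrue-true {zero} f e with f zero in f₀
... | true = refl
firstTrue-true {suc k} f e with f zero in f₀
... | true = f₀
... | false = firstTrue-true (f ∘ suc) e

anyFin-intro : ∀ {k} (f : Fin k → Bool) i → f i ≡ true → anyFin f ≡ true
anyFin-intro f zero fᵢ rewrite fᵢ = refl
anyFin-intro f (suc i) fᵢ with f zero
... | true = refl
... | false = anyFin-intro (f ∘ suc) i fᵢ

module Construction {n : ℕ} {adj : Adj n} (G : IsGraph adj) (D : TreeDecomposition adj) (b : ℕ)
  (torsoBasis : ∀ t → BnAtMost (torso D t) b) (P : PathFamily D) (captures : CapturesAdhesions D P) where
  open TreeDecomposition D
  open TreeFacts D
  open Joins G

  pathOf : Node → Fin n → Fin n → ESet n
  pathOf s x y u v = hasEdge u v (P s x y)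

  present : Node → Fin n → Fin n → Bool
  present s x y = (x ≺ y) ∧ A s x ∧ A s y

  pathOf-isJoin : ∀ s x y → present s x y ≡ true → IsJoin x y (pathOf s x y)
  pathOf-isJoin s x y p = path-isJoin x y (P s x y)
    (captures s x y (≺⇒< (∧-trueˡ p)) (∧-trueˡ (∧-trueʳ {x ≺ y} p)) (∧-trueʳ {A s x} (∧-trueʳ {x ≺ y} p)))

  childWith : Node → Fin n → Fin n → Node → Bool
  childWith t x y s = isChildOf D s t ∧ A s x ∧ A s y

  -- The last case covers torso edges that come from the adhesion of a child of t.
  realise : Node → Fin n → Fin n → ESet n
  realise t x y =
    if A t x ∧ A t y then pathOf t x y
    else if adj x y then edge x y
    else pathOf (firstTrue (childWith t x y)) x y

  realise-adhesion : ∀ t x y → (A t x ∧ A t y) ≡ true → realise t x y ≡ pathOf t x y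
  realise-adhesion t x y e rewrite e = refl

  realise-edge : ∀ t x y → (A t x ∧ A t y) ≡ false → adj x y ≡ true → realise t x y ≡ edge x y
  realise-edge t x y e xy rewrite e | xy = refl

  realise-child : ∀ t x y → (A t x ∧ A t y) ≡ false → adj x y ≡ false →
                  realise t x y ≡ pathOf (firstTrue (childWith t x y)) x y
  realise-child t x y e ¬xy rewrite e | ¬xy = refl

  torso-reason : ∀ t x y → torso D t x y ≡ true → (adj x y ∨ (A t x ∧ A t y) ∨ anyFin (childWith t x y)) ≡ true
  torso-reason t x y e = ∧-trueʳ {not (x == y)} (∧-trueʳ {bag t y} (∧-trueʳ {bag t x} e))

  torso-intro : ∀ t x y → bag t x ≡ true → bag t y ≡ true → (x == y) ≡ false →
                (adj x y ∨ (A t x ∧ A t y) ∨ anyFin (childWith t x y)) ≡ true → torso D t x y ≡ true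
  torso-intro t x y bx by x≠y h rewrite bx | by | x≠y = h

  basisSize : ∀ t → ℕ
  basisSize t = proj₁ (torsoBasis t)

  basisOf : ∀ t → Fin (basisSize t) → ESet n
  basisOf t = proj₁ (proj₂ (torsoBasis t))

  basisOf-isBasis : ∀ t → IsCycleBasis (torso D t) (basisOf t)
  basisOf-isBasis t = proj₁ (proj₂ (proj₂ (torsoBasis t)))

  basisOf-congestion : ∀ t → CongestionAtMost (basisOf t) b
  basisOf-congestion t = proj₂ (proj₂ (proj₂ (torsoBasis t)))

  image : ∀ t → Fin (basisSize t) → ESet n
  image t i = substitute (basisOf t i) (realise t)

  images : List (ESet n)
  images = concat (tabulate λ t → tabulate (image t))

  edgeIfPresent : Fin n → Fin n → List (ESet n)
  edgeIfPresent x y = if (x ≺ y) ∧ adj x y then edge x y ∷ [] else []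

  paths : Fin n → Fin n → List (ESet n)
  paths x y = selected (λ s → present s x y) (λ s → pathOf s x y)

  joins : Fin n → Fin n → List (ESet n)
  joins x y = edgeIfPresent x y ++ paths x y

  corrections : List (ESet n)
  corrections = concat (tabulate λ x → concat (tabulate λ y → differences (joins x y)))

  family : List (ESet n)
  family = images ++ corrections

  joins-isJoin : ∀ x y → All (IsJoin x y) (joins x y)
  joins-isJoin x y = AllP.++⁺ edgeCase (all-selected _ _ (λ s → pathOf-isJoin s x y))
    where
    edgeCase : All (IsJoin x y) (edgeIfPresent x y)
    edgeCase with (x ≺ y) ∧ adj x y in e
    ... | true = edge-isJoin x y (∧-trueʳ {x ≺ y} e) ∷ []
    ... | false = []

  realise-∈-joins : ∀ t x y → (x ≺ y) ≡ true → torso D t x y ≡ true → realise t x y ∈ joins x y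
  realise-∈-joins t x y x≺y txy with A t x ∧ A t y in axy | adj x y in xy | torso-reason t x y txy
  ... | true | _ | _ = ∈-++⁺ʳ _ (∈-selected (λ s → present s x y) (λ s → pathOf s x y) t (cong₂ _∧_ x≺y axy))
  ... | false | true | _ rewrite x≺y | xy = here refl
  ... | false | false | carried =
    ∈-++⁺ʳ _ (∈-selected (λ s → present s x y) (λ s → pathOf s x y) c (cong₂ _∧_ x≺y (∧-trueʳ {isChildOf D c t} carries)))
    where
    c : Node
    c = firstTrue (childWith t x y)
    carries : childWith t x y c ≡ true
    carries = firstTrue-true (childWith t x y) carried

  realise-isJoin : ∀ t x y → (x ≺ y) ≡ true → torso D t x y ≡ true → IsJoin x y (realise t x y)
  realise-isJoin t x y x≺y txy = All.lookup (joins-isJoin x y) (realise-∈-joins t x y x≺y txy)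

  joins-∼ : ∀ x y {Z Z′} → Z ∈ joins x y → Z′ ∈ joins x y → Z ∼[ family ] Z′
  joins-∼ x y m m′ = ∼-mono (∈-++⁺ʳ images ∘ ∈-concat-tabulate (λ x → concat (tabulate λ y → differences (joins x y))) x
                                           ∘ ∈-concat-tabulate (λ y → differences (joins x y)) y)
                            (differences-∼ (joins x y) m m′)

  image-∈-family : ∀ t i → image t i ∈ family
  image-∈-family t i = ∈-++⁺ˡ (∈-concat-tabulate (λ t → tabulate (image t)) t (∈-tabulate⁺ i))

  image-isCycle : ∀ t i → IsCycle (image t i)
  image-isCycle t i =
    substitute-isEdgeSubset B (realise t) (λ x y o → proj₁ (realise-isJoin′ x y o)) ,
    λ v → trans (substitute-boundary B (realise t) (IsEdgeSubset.sym B⊆torso) (IsEdgeSubset.irrefl B⊆torso)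
                                     (λ x y o → proj₂ (realise-isJoin′ x y o)) v)
                (even⇒⨁-false (B v) (IsCycleBasis.members-cycle (basisOf-isBasis t) i v))
    where
    B : ESet n
    B = basisOf t i
    B⊆torso : IsEdgeSubset (torso D t) B
    B⊆torso = IsCycleBasis.members-sub (basisOf-isBasis t) i
    realise-isJoin′ : ∀ x y → oriented B x y ≡ true → IsJoin x y (realise t x y)
    realise-isJoin′ x y o = realise-isJoin t x y (∧-trueˡ o) (IsEdgeSubset.sub B⊆torso x y (∧-trueʳ {x ≺ y} o))

  family-isCycle : All IsCycle family
  family-isCycle = AllP.++⁺ (all-concat-tabulate _ λ t → AllP.tabulate⁺ (image-isCycle t))
                            (all-concat-tabulate _ λ x → all-concat-tabulate _ λ y → all-differences isJoin-⊕ (joins-isJoin x y))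

  -- Spanning: the cycles of G are generated by the family

  pending : (Node → ESet n) → ESet n
  pending V u v = ⨁ λ s → substitute (V s) (pathOf s) u v

  residual : ESet n → (Node → ESet n) → ESet n
  residual S V = S ⊕ pending V

  -- The edge set S together with the adhesion pairs V s, realised by their paths, forms a cycle that
  -- still has to be generated; its edges are owned by, and its pairs pending at parents among, the
  -- nodes numbered below j.
  record Stage (j : ℕ) (S : ESet n) (V : Node → ESet n) : Set where
    field
      S-edges    : IsEdgeSubset adj S
      V-sym      : ∀ s x y → V s x y ≡ V s y x
      V-irrefl   : ∀ s x → V s x x ≡ false
      V-adhesion : ∀ s x y → V s x y ≡ true → A s x ≡ true × A s y ≡ true
      S-owner    : ∀ x y → S x y ≡ true → ∀ t → owns t x y ≡ true → toℕ t < j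
      V-parent   : ∀ i x y → V (suc i) x y ≡ true → toℕ (par i) < j
      balanced   : ∀ v → ⨁ (S v) xor ⨁ (λ s → ⨁ (V s v)) ≡ false

  stage-zero : ∀ {S V} → Stage 0 S V → InSpan family (residual S V)
  stage-zero {S} {V} stage = span-∅ λ u v → cong₂ _xor_ (S-empty u v) (⨁-false {suc m} _ λ s → substitute-∅ (pathOf s) (V-empty s) u v)
    where
    open Stage stage
    S-empty : ∀ x y → S x y ≡ false
    S-empty x y with S x y in e
    ... | false = refl
    ... | true with t , bx , by ← edges x y (IsEdgeSubset.sub S-edges x y e)
               with t′ , o ← owner-exists x y t bx by
               with () ← S-owner x y e t′ o
    V-empty : ∀ s → V s ≐ ∅
    V-empty zero x y with V zero x y in e
    ... | false = refl
    ... | true with () , _ ← V-adhesion zero x y e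
    V-empty (suc i) x y with V (suc i) x y in e
    ... | false = refl
    ... | true with () ← V-parent i x y e

  -- Stage j + 1 reduces to stage j by generating the part of the cycle that lives at node j.
  module Step (j : ℕ) (j<m : j < suc m) {S : ESet n} {V : Node → ESet n} (stage : Stage (suc j) S V) where
    open Stage stage

    t : Node
    t = fromℕ< j<m

    t≡j : toℕ t ≡ j
    t≡j = toℕ-fromℕ< j<m

    toℕ≡j⇒≡t : ∀ t′ → toℕ t′ ≡ j → t′ ≡ t
    toℕ≡j⇒≡t t′ e = toℕ-injective (trans e (sym t≡j))

    isChild : Node → Bool
    isChild s = isChildOf D s t

    isChild⇒parent : ∀ s → isChild s ≡ true → ∃ λ i → s ≡ suc i × par i ≡ t
    isChild⇒parent (suc i) e = i , refl , ==⇒≡ e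

    Sₜ : ESet n
    Sₜ x y = S x y ∧ owns t x y

    Vₜ : ESet n
    Vₜ x y = ⨁ λ s → isChild s ∧ V s x y

    C₀ : ESet n
    C₀ = Sₜ ⊕ Vₜ

    odd : Fin n → Bool
    odd v = ⨁ (C₀ v)

    S-owned-by-t : ∀ v w → S v w ≡ true → bag t v ≡ true → A t v ≡ false → owns t v w ≡ true
    S-owned-by-t v w e bv av with t₀ , b₀ , b₁ ← edges v w (IsEdgeSubset.sub S-edges v w e)
                             with t′ , o ← owner-exists v w t₀ b₀ b₁ =
      subst (λ z → owns z v w ≡ true)
            (toℕ≡j⇒≡t t′ (≤-antisym (≤-pred (S-owner v w e t′ o))
                                     (subst (_≤ toℕ t′) t≡j (non-adhesion-minimal v t t′ bv av (owns⇒bagˡ t′ v w o)))))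
            o

    V-at-child : ∀ s v w → V s v w ≡ true → bag t v ≡ true → A t v ≡ false → isChild s ≡ true
    V-at-child zero v w e bv av with () , _ ← V-adhesion zero v w e
    V-at-child (suc i) v w e bv av = subst (λ z → (par i == z) ≡ true) parent≡t (==-refl (par i))
      where
      parent≡t : par i ≡ t
      parent≡t = toℕ≡j⇒≡t (par i) (≤-antisym (≤-pred (V-parent i v w e))
                   (subst (_≤ toℕ (par i)) t≡j
                     (non-adhesion-minimal v t (par i) bv av (adhesion⇒bag-parent i v (proj₁ (V-adhesion (suc i) v w e))))))

    odd-outside-bag : ∀ v → bag t v ≡ false → odd v ≡ false
    odd-outside-bag v bv = ⨁-false {n} _ λ w → cong₂ _xor_ (Sₜ-empty w) (⨁-false {suc m} _ (Vₜ-empty w))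
      where
      Sₜ-empty : ∀ w → Sₜ v w ≡ false
      Sₜ-empty w = trans (cong (λ z → S v w ∧ (z ∧ (bag t w ∧ not (A t v ∧ A t w)))) bv) (∧-zeroʳ (S v w))
      Vₜ-empty : ∀ w s → (isChild s ∧ V s v w) ≡ false
      Vₜ-empty w s with isChild s in cs | V s v w in vs
      ... | false | _ = refl
      ... | true | false = refl
      ... | true | true with i , refl , pᵢ ← isChild⇒parent s cs =
        ⊥-elim (false≢true (trans (sym bv) (subst (λ z → bag z v ≡ true) pᵢ
                                                  (adhesion⇒bag-parent i v (proj₁ (V-adhesion (suc i) v w vs))))))

    -- Inside β(t) but outside its adhesion, C₀ agrees near v with the balanced S + Σ V.
    odd-outside-adhesion : ∀ v → bag t v ≡ true → A t v ≡ false → odd v ≡ false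
    odd-outside-adhesion v bv av = begin
      ⨁ (λ w → Sₜ v w xor Vₜ v w)            ≡⟨ ⨁-distrib-xor (Sₜ v) (Vₜ v) ⟩
      ⨁ (Sₜ v) xor ⨁ (Vₜ v)                  ≡⟨ cong₂ _xor_ (⨁-cong λ w → ∧-absorbʳ (λ e → S-owned-by-t v w e bv av))
                                                            (trans (⨁-cong λ w → ⨁-cong λ s → onlyChildren w s)
                                                                   (⨁-comm (λ w s → V s v w))) ⟩
      ⨁ (S v) xor ⨁ (λ s → ⨁ (V s v))        ≡⟨ balanced v ⟩
      false                                   ∎
      where
      open ≡-Reasoning
      onlyChildren : ∀ w s → (isChild s ∧ V s v w) ≡ V s v w
      onlyChildren w s = trans (∧-comm (isChild s) (V s v w)) (∧-absorbʳ (λ e → V-at-child s v w e bv av))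

    odd⇒adhesion : ∀ v → odd v ≡ true → A t v ≡ true
    odd⇒adhesion v ov = byCases (A t v) refl (bag t v) refl
      where
      byCases : ∀ a → A t v ≡ a → ∀ β → bag t v ≡ β → A t v ≡ true
      byCases true av _ _ = av
      byCases false av false bv = ⊥-elim (false≢true (trans (sym (odd-outside-bag v bv)) ov))
      byCases false av true bv = ⊥-elim (false≢true (trans (sym (odd-outside-adhesion v bv av)) ov))

    C₀-sym : ∀ x y → C₀ x y ≡ C₀ y x
    C₀-sym x y = cong₂ _xor_ (cong₂ _∧_ (IsEdgeSubset.sym S-edges x y) (owns-sym t x y))
                             (⨁-cong λ s → cong (isChild s ∧_) (V-sym s x y))

    C₀-irrefl : ∀ x → C₀ x x ≡ false
    C₀-irrefl x = cong₂ _xor_ (cong (_∧ owns t x x) (IsEdgeSubset.irrefl S-edges x))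
                              (⨁-false {suc m} _ λ s → trans (cong (isChild s ∧_) (V-irrefl s x)) (∧-zeroʳ (isChild s)))

    -- The odd vertices of C₀ all lie in the clique β(t) ∩ β(parent t), so a star on them fixes the parity.
    star : Fin n → ESet n
    star a x y = ((a == x) ∧ (odd y ∧ not (a == y))) xor ((a == y) ∧ (odd x ∧ not (a == x)))

    fixOf : Dec (∃ λ a → odd a ≡ true) → ESet n
    fixOf (yes (a , _)) = star a
    fixOf (no _) = ∅

    fix? : Dec (∃ λ a → odd a ≡ true)
    fix? = any? λ a → odd a ≟ᵇ true

    F : ESet n
    F = fixOf fix?

    fixOf-boundary : ∀ d v → ⨁ (fixOf d v) ≡ odd v
    fixOf-boundary (no ¬odd) v with odd v in ov
    ... | false = ⨁-false {n} _ λ _ → refl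
    ... | true = ⊥-elim (¬odd (v , ov))
    fixOf-boundary (yes (a , oa)) v = begin
      ⨁ (λ w → ((a == v) ∧ (odd w ∧ not (a == w))) xor ((a == w) ∧ K))
        ≡⟨ ⨁-distrib-xor (λ w → (a == v) ∧ (odd w ∧ not (a == w))) (λ w → (a == w) ∧ K) ⟩
      ⨁ (λ w → (a == v) ∧ (odd w ∧ not (a == w))) xor ⨁ (λ w → (a == w) ∧ K)
        ≡⟨ cong₂ _xor_ (trans (∧-distribˡ-⨁ {n} (a == v) _) (cong ((a == v) ∧_) othersOdd)) (⨁-select a (λ _ → K)) ⟩
      ((a == v) ∧ true) xor K
        ≡⟨ atCentre (a == v) refl ⟩
      odd v ∎
      where
      open ≡-Reasoning
      K : Bool
      K = odd v ∧ not (a == v)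
      othersOdd : ⨁ (λ w → odd w ∧ not (a == w)) ≡ true
      othersOdd = begin
        ⨁ (λ w → odd w ∧ not (a == w))      ≡⟨ ⨁-cong (λ w → ∧-not≡xor-∧ (odd w) (a == w)) ⟩
        ⨁ (λ w → odd w xor ((a == w) ∧ odd w)) ≡⟨ ⨁-distrib-xor odd (λ w → (a == w) ∧ odd w) ⟩
        ⨁ odd xor ⨁ (λ w → (a == w) ∧ odd w) ≡⟨ cong₂ _xor_ (handshake C₀ C₀-sym C₀-irrefl) (⨁-select a odd) ⟩
        odd a                                  ≡⟨ oa ⟩
        true                                   ∎
      atCentre : ∀ c → (a == v) ≡ c → (c ∧ true) xor (odd v ∧ not c) ≡ odd v
      atCentre false _ = ∧-identityʳ (odd v)
      atCentre true e rewrite ==⇒≡ {u = a} {v} e | oa = refl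

    fixOf-sym : ∀ d x y → fixOf d x y ≡ fixOf d y x
    fixOf-sym (yes (a , _)) x y = xor-comm ((a == x) ∧ (odd y ∧ not (a == y))) _
    fixOf-sym (no _) x y = refl

    fixOf-irrefl : ∀ d x → fixOf d x x ≡ false
    fixOf-irrefl (yes (a , _)) x = xor-same ((a == x) ∧ (odd x ∧ not (a == x)))
    fixOf-irrefl (no _) x = refl

    fixOf-adhesion : ∀ d x y → fixOf d x y ≡ true → A t x ≡ true × A t y ≡ true
    fixOf-adhesion (yes (a , oa)) x y e with xor-true {(a == x) ∧ (odd y ∧ not (a == y))} e
    ... | inj₁ e₁ = odd⇒adhesion x (subst (λ z → odd z ≡ true) (==⇒≡ (∧-trueˡ e₁)) oa)
                  , odd⇒adhesion y (∧-trueˡ (∧-trueʳ {a == x} e₁))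
    ... | inj₂ e₂ = odd⇒adhesion x (∧-trueˡ (∧-trueʳ {a == y} e₂))
                  , odd⇒adhesion y (subst (λ z → odd z ≡ true) (==⇒≡ (∧-trueˡ e₂)) oa)

    C : ESet n
    C = C₀ ⊕ F

    C-even : ∀ v → ⨁ (C v) ≡ false
    C-even v = trans (⨁-distrib-xor (C₀ v) (F v)) (trans (cong (odd v xor_) (fixOf-boundary fix? v)) (xor-same (odd v)))

    child-pair-torso : ∀ s x y → (isChild s ∧ V s x y) ≡ true → torso D t x y ≡ true
    child-pair-torso s x y e with i , refl , pᵢ ← isChild⇒parent s (∧-trueˡ e) =
      torso-intro t x y (inBag x ax) (inBag y ay) (irrefl⇒distinct (V (suc i)) (V-irrefl (suc i)) x y vxy)
        (∨-introʳ {adj x y} (∨-introʳ {A t x ∧ A t y}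
          (anyFin-intro (childWith t x y) (suc i) (∧-true (∧-trueˡ {isChild (suc i)} e) (∧-true ax ay)))))
      where
      vxy : V (suc i) x y ≡ true
      vxy = ∧-trueʳ {isChild (suc i)} e
      ax : A (suc i) x ≡ true
      ax = proj₁ (V-adhesion (suc i) x y vxy)
      ay : A (suc i) y ≡ true
      ay = proj₂ (V-adhesion (suc i) x y vxy)
      inBag : ∀ z → A (suc i) z ≡ true → bag t z ≡ true
      inBag z az = subst (λ r → bag r z ≡ true) pᵢ (adhesion⇒bag-parent i z az)

    C-torso : ∀ x y → C x y ≡ true → torso D t x y ≡ true
    C-torso x y e with xor-true {C₀ x y} e
    ... | inj₂ fxy = torso-intro t x y (adhesion⇒bag t x ax) (adhesion⇒bag t y ay)
                       (irrefl⇒distinct F (fixOf-irrefl fix?) x y fxy) (∨-introʳ {adj x y} (∨-introˡ (∧-true ax ay)))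
      where
      ax : A t x ≡ true
      ax = proj₁ (fixOf-adhesion fix? x y fxy)
      ay : A t y ≡ true
      ay = proj₂ (fixOf-adhesion fix? x y fxy)
    ... | inj₁ c₀xy with xor-true {Sₜ x y} c₀xy
    ...   | inj₁ sₜxy = torso-intro t x y (owns⇒bagˡ t x y o) (owns⇒bagʳ t x y o)
                          (irrefl⇒distinct S (IsEdgeSubset.irrefl S-edges) x y sxy) (∨-introˡ (IsEdgeSubset.sub S-edges x y sxy))
      where
      sxy : S x y ≡ true
      sxy = ∧-trueˡ sₜxy
      o : owns t x y ≡ true
      o = ∧-trueʳ {S x y} sₜxy
    ...   | inj₂ vₜxy with s , e′ ← ⨁-true _ vₜxy = child-pair-torso s x y e′

    C-cycle : IsEdgeSubset (torso D t) C
    C-cycle = record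
      { sym = λ x y → cong₂ _xor_ (C₀-sym x y) (fixOf-sym fix? x y)
      ; irrefl = λ x → cong₂ _xor_ (C₀-irrefl x) (fixOf-irrefl fix? x)
      ; sub = C-torso }

    realised-C-inSpan : InSpan family (substitute C (realise t))
    realised-C-inSpan = InSpan-resp (≐-trans (≐-sym (substitute-combo σ (basisOf t) (realise t)))
                                             (substitute-cong (realise t) σ-gives-C))
                                    (InSpan-combo σ (image t) λ i → span-∈ _ (image-∈-family t i) λ _ _ → refl)
      where
      combination : IsCombinationOf (basisOf t) C
      combination = IsCycleBasis.spanning (basisOf-isBasis t) C C-cycle λ v → ⨁-false⇒even (C v) (C-even v)
      σ : Fin (basisSize t) → Bool
      σ = proj₁ combination
      σ-gives-C : combo σ (basisOf t) ≐ C
      σ-gives-C = proj₂ combination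

    childPairs : Node → ESet n
    childPairs s x y = isChild s ∧ V s x y

    Δ : ESet n
    Δ = Sₜ ⊕ (pending childPairs ⊕ substitute F (pathOf t))

    realised-Sₜ : substitute Sₜ (realise t) ∼[ family ] Sₜ
    realised-Sₜ = ∼-trans (substitute-∼ Sₜ (realise t) edge byEdge)
                          (≐⇒∼ (substitute-edge Sₜ (λ x y → cong₂ _∧_ (IsEdgeSubset.sym S-edges x y) (owns-sym t x y))
                                                   (λ x → cong (_∧ owns t x x) (IsEdgeSubset.irrefl S-edges x))))
      where
      byEdge : ∀ x y → oriented Sₜ x y ≡ true → realise t x y ∼[ family ] edge x y
      byEdge x y o = ≐⇒∼ λ u v → cong (λ Z → Z u v) (realise-edge t x y (owns⇒¬adhesion t x y (∧-trueʳ {S x y} sₜxy))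
                                                                         (IsEdgeSubset.sub S-edges x y (∧-trueˡ sₜxy)))
        where sₜxy = ∧-trueʳ {x ≺ y} o

    realised-Vₜ : substitute Vₜ (realise t) ∼[ family ] pending childPairs
    realised-Vₜ = ∼-trans (≐⇒∼ (substitute-⨁ childPairs (realise t)))
                          (∼-⨁ (λ s → substitute (childPairs s) (realise t)) (λ s → substitute (childPairs s) (pathOf s))
                               λ s → substitute-∼ (childPairs s) (realise t) (pathOf s) (byChildPath s))
      where
      byChildPath : ∀ s x y → oriented (childPairs s) x y ≡ true → realise t x y ∼[ family ] pathOf s x y
      byChildPath s x y o = joins-∼ x y (realise-∈-joins t x y x≺y (child-pair-torso s x y pair))
                                        (∈-++⁺ʳ _ (∈-selected (λ s → present s x y) (λ s → pathOf s x y) s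
                                                   (∧-true x≺y (∧-true (proj₁ adh) (proj₂ adh)))))
        where
        x≺y : (x ≺ y) ≡ true
        x≺y = ∧-trueˡ o
        pair : childPairs s x y ≡ true
        pair = ∧-trueʳ {x ≺ y} o
        adh : A s x ≡ true × A s y ≡ true
        adh = V-adhesion s x y (∧-trueʳ {isChild s} pair)

    realised-F : substitute F (realise t) ∼[ family ] substitute F (pathOf t)
    realised-F = substitute-∼ F (realise t) (pathOf t) λ x y o →
      let (ax , ay) = fixOf-adhesion fix? x y (∧-trueʳ {x ≺ y} o)
      in ≐⇒∼ λ u v → cong (λ Z → Z u v) (realise-adhesion t x y (∧-true ax ay))

    Δ-inSpan : InSpan family Δ
    Δ-inSpan = InSpan-∼ realised-C-inSpan (∼-trans (≐⇒∼ split) (∼-trans (∼-⊕ (∼-⊕ realised-Sₜ realised-Vₜ) realised-F)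
                                                                        (≐⇒∼ reassoc)))
      where
      split : substitute C (realise t) ≐ (substitute Sₜ (realise t) ⊕ substitute Vₜ (realise t)) ⊕ substitute F (realise t)
      split u v = trans (substitute-⊕ C₀ F (realise t) u v) (cong (_xor substitute F (realise t) u v) (substitute-⊕ Sₜ Vₜ (realise t) u v))
      reassoc : (Sₜ ⊕ pending childPairs) ⊕ substitute F (pathOf t) ≐ Δ
      reassoc u v = xor-assoc (Sₜ u v) (pending childPairs u v) _

    S′ : ESet n
    S′ = S ⊕ Sₜ

    V′ : Node → ESet n
    V′ s x y = (V s x y ∧ not (isChild s)) xor ((t == s) ∧ F x y)

    residual-split : residual S V ≐ residual S′ V′ ⊕ Δ
    residual-split u v = begin
      S u v xor pending V u v
        ≡⟨ cong (S u v xor_) pending-split ⟩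
      S u v xor ((pending V′ u v xor pending childPairs u v) xor substitute F (pathOf t) u v)
        ≡⟨ regroup (S u v) (Sₜ u v) (pending V′ u v) (pending childPairs u v) (substitute F (pathOf t) u v) ⟩
      (S′ u v xor pending V′ u v) xor Δ u v ∎
      where
      open ≡-Reasoning
      open xor-∧-Solver
      regroup : ∀ s sₜ p c f → s xor ((p xor c) xor f) ≡ ((s xor sₜ) xor p) xor (sₜ xor (c xor f))
      regroup = solve 5 (λ s sₜ p c f → s :+ ((p :+ c) :+ f) := ((s :+ sₜ) :+ p) :+ (sₜ :+ (c :+ f))) refl
      atT : Node → ESet n
      atT s x y = (t == s) ∧ F x y
      V-split : ∀ s → V s ≐ (V′ s ⊕ childPairs s) ⊕ atT s
      V-split s x y = trans (reorder (V s x y) (isChild s) ((t == s) ∧ F x y))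
                            (cong (λ z → ((z xor ((t == s) ∧ F x y)) xor (isChild s ∧ V s x y)) xor ((t == s) ∧ F x y))
                                  (sym (∧-not≡xor-∧ (V s x y) (isChild s))))
        where
        reorder : ∀ a c g → a ≡ (((a xor (c ∧ a)) xor g) xor (c ∧ a)) xor g
        reorder = solve 3 (λ a c g → a := (((a :+ (c :* a)) :+ g) :+ (c :* a)) :+ g) refl
      pending-split : pending V u v ≡ (pending V′ u v xor pending childPairs u v) xor substitute F (pathOf t) u v
      pending-split = begin
        ⨁ (λ s → substitute (V s) (pathOf s) u v)
          ≡⟨ ⨁-cong (λ s → trans (substitute-cong (pathOf s) (V-split s) u v)
                                 (trans (substitute-⊕ (V′ s ⊕ childPairs s) (atT s) (pathOf s) u v)
                                        (cong (_xor substitute (atT s) (pathOf s) u v) (substitute-⊕ (V′ s) (childPairs s) (pathOf s) u v)))) ⟩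
        ⨁ (λ s → (substitute (V′ s) (pathOf s) u v xor substitute (childPairs s) (pathOf s) u v) xor substitute (atT s) (pathOf s) u v)
          ≡⟨ trans (⨁-distrib-xor (λ s → substitute (V′ s) (pathOf s) u v xor substitute (childPairs s) (pathOf s) u v)
                                  (λ s → substitute (atT s) (pathOf s) u v))
                   (cong₂ _xor_ (⨁-distrib-xor (λ s → substitute (V′ s) (pathOf s) u v) (λ s → substitute (childPairs s) (pathOf s) u v))
                                (trans (⨁-cong λ s → substitute-∧ (t == s) F (pathOf s) u v)
                                       (⨁-select t (λ s → substitute F (pathOf s) u v)))) ⟩
        (pending V′ u v xor pending childPairs u v) xor substitute F (pathOf t) u v ∎

    V′-degree : ∀ v → ⨁ (λ s → ⨁ (V′ s v)) ≡ (⨁ (λ s → ⨁ (V s v)) xor ⨁ (Vₜ v)) xor odd v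
    V′-degree v = begin
      ⨁ (λ s → ⨁ (V′ s v))
        ≡⟨ ⨁-cong (λ s → trans (⨁-cong λ w → cong (_xor ((t == s) ∧ F v w)) (∧-not≡xor-∧ (V s v w) (isChild s)))
                               (trans (⨁-distrib-xor (λ w → V s v w xor childPairs s v w) (λ w → (t == s) ∧ F v w))
                                      (cong₂ _xor_ (⨁-distrib-xor (V s v) (childPairs s v)) (∧-distribˡ-⨁ (t == s) (F v))))) ⟩
      ⨁ (λ s → (⨁ (V s v) xor ⨁ (childPairs s v)) xor ((t == s) ∧ ⨁ (F v)))
        ≡⟨ trans (⨁-distrib-xor (λ s → ⨁ (V s v) xor ⨁ (childPairs s v)) (λ s → (t == s) ∧ ⨁ (F v)))
                 (cong₂ _xor_ (⨁-distrib-xor (λ s → ⨁ (V s v)) (λ s → ⨁ (childPairs s v))) (⨁-select t (λ _ → ⨁ (F v)))) ⟩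
      (⨁ (λ s → ⨁ (V s v)) xor ⨁ (λ s → ⨁ (childPairs s v))) xor ⨁ (F v)
        ≡⟨ cong₂ (λ c f → (⨁ (λ s → ⨁ (V s v)) xor c) xor f) (⨁-comm (λ s w → childPairs s v w)) (fixOf-boundary fix? v) ⟩
      (⨁ (λ s → ⨁ (V s v)) xor ⨁ (Vₜ v)) xor odd v ∎
      where open ≡-Reasoning

    below-t : ∀ {t′} → toℕ t′ < suc j → t′ ≢ t → toℕ t′ < j
    below-t {t′} t′<1+j t′≢t = ≤∧≢⇒< (≤-pred t′<1+j) (t′≢t ∘ toℕ≡j⇒≡t t′)

    S′⇒unowned : ∀ {x y} → S x y xor Sₜ x y ≡ true → S x y ≡ true × owns t x y ≡ false
    S′⇒unowned {x} {y} e with S x y | owns t x y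
    ... | true | false = refl , refl

    V′-adhesion : ∀ s x y → V′ s x y ≡ true → A s x ≡ true × A s y ≡ true
    V′-adhesion s x y e with xor-true {V s x y ∧ not (isChild s)} e
    ... | inj₁ e₁ = V-adhesion s x y (∧-trueˡ e₁)
    ... | inj₂ e₂ with refl ← ==⇒≡ {u = t} {s} (∧-trueˡ e₂) = fixOf-adhesion fix? x y (∧-trueʳ {t == s} e₂)

    S′-owner : ∀ x y → S′ x y ≡ true → ∀ t′ → owns t′ x y ≡ true → toℕ t′ < j
    S′-owner x y e t′ o with sxy , ¬owned ← S′⇒unowned {x} {y} e =
      below-t (S-owner x y sxy t′ o) λ { refl → false≢true (trans (sym ¬owned) o) }

    V′-parent : ∀ i x y → V′ (suc i) x y ≡ true → toℕ (par i) < j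
    V′-parent i x y e with xor-true {V (suc i) x y ∧ not (isChild (suc i))} e
    ... | inj₁ e₁ = below-t (V-parent i x y (∧-trueˡ e₁)) λ pᵢ≡t →
                      false≢true (trans (sym (notChild e₁)) (subst (λ z → (par i == z) ≡ true) pᵢ≡t (==-refl (par i))))
      where
      notChild : ∀ {a} → a ∧ not (isChild (suc i)) ≡ true → isChild (suc i) ≡ false
      notChild {a} e with isChild (suc i) | ∧-trueʳ {a} e
      ... | false | _ = refl
    ... | inj₂ e₂ = subst (toℕ (par i) <_) (trans (cong toℕ (sym (==⇒≡ {u = t} {suc i} (∧-trueˡ e₂)))) t≡j) (s≤s (par-ord i))

    balanced′ : ∀ v → ⨁ (S′ v) xor ⨁ (λ s → ⨁ (V′ s v)) ≡ false
    balanced′ v = begin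
      ⨁ (S′ v) xor ⨁ (λ s → ⨁ (V′ s v))
        ≡⟨ cong₂ _xor_ (⨁-distrib-xor (S v) (Sₜ v)) (V′-degree v) ⟩
      (⨁ (S v) xor ⨁ (Sₜ v)) xor ((⨁ (λ s → ⨁ (V s v)) xor ⨁ (Vₜ v)) xor odd v)
        ≡⟨ cong (λ o → (⨁ (S v) xor ⨁ (Sₜ v)) xor ((⨁ (λ s → ⨁ (V s v)) xor ⨁ (Vₜ v)) xor o))
                (⨁-distrib-xor (Sₜ v) (Vₜ v)) ⟩
      (⨁ (S v) xor ⨁ (Sₜ v)) xor ((⨁ (λ s → ⨁ (V s v)) xor ⨁ (Vₜ v)) xor (⨁ (Sₜ v) xor ⨁ (Vₜ v)))
        ≡⟨ cancel (⨁ (S v)) (⨁ (Sₜ v)) (⨁ (λ s → ⨁ (V s v))) (⨁ (Vₜ v)) ⟩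
      ⨁ (S v) xor ⨁ (λ s → ⨁ (V s v))
        ≡⟨ balanced v ⟩
      false ∎
      where
      open ≡-Reasoning
      open xor-∧-Solver
      cancel : ∀ a b c d → (a xor b) xor ((c xor d) xor (b xor d)) ≡ a xor c
      cancel = solve 4 (λ a b c d → (a :+ b) :+ ((c :+ d) :+ (b :+ d)) := a :+ c) refl

    next : Stage j S′ V′
    next = record
      { S-edges = record { sym = λ x y → cong₂ _xor_ (IsEdgeSubset.sym S-edges x y)
                                                      (cong₂ _∧_ (IsEdgeSubset.sym S-edges x y) (owns-sym t x y))
                         ; irrefl = λ x → cong₂ _xor_ (IsEdgeSubset.irrefl S-edges x) (cong (_∧ owns t x x) (IsEdgeSubset.irrefl S-edges x))
                         ; sub = λ x y e → IsEdgeSubset.sub S-edges x y (proj₁ (S′⇒unowned e)) }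
      ; V-sym = λ s x y → cong₂ _xor_ (cong (_∧ not (isChild s)) (V-sym s x y)) (cong ((t == s) ∧_) (fixOf-sym fix? x y))
      ; V-irrefl = λ s x → cong₂ _xor_ (cong (_∧ not (isChild s)) (V-irrefl s x))
                                       (trans (cong ((t == s) ∧_) (fixOf-irrefl fix? x)) (∧-zeroʳ (t == s)))
      ; V-adhesion = V′-adhesion
      ; S-owner = S′-owner
      ; V-parent = V′-parent
      ; balanced = balanced′ }

    descend : InSpan family (residual S′ V′) → InSpan family (residual S V)
    descend rest = InSpan-resp (≐-sym residual-split) (InSpan-⊕ rest Δ-inSpan)

  stage-inSpan : ∀ j → j ≤ suc m → ∀ {S V} → Stage j S V → InSpan family (residual S V)
  stage-inSpan zero _ = stage-zero
  stage-inSpan (suc j) j<m stage = Step.descend j j<m stage (stage-inSpan j (≤-trans (n≤1+n j) j<m) (Step.next j j<m stage))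

  cycle-inSpan : ∀ S → IsEdgeSubset adj S → IsF2Cycle S → InSpan family S
  cycle-inSpan S S-edges S-cycle = InSpan-resp nothing-pending (stage-inSpan (suc m) ≤-refl initial)
    where
    initial : Stage (suc m) S (λ _ → ∅)
    initial = record
      { S-edges = S-edges ; V-sym = λ _ _ _ → refl ; V-irrefl = λ _ _ → refl ; V-adhesion = λ _ _ _ ()
      ; S-owner = λ _ _ _ t _ → toℕ<n t ; V-parent = λ _ _ _ ()
      ; balanced = λ v → cong₂ _xor_ (even⇒⨁-false (S v) (S-cycle v)) (⨁-false {suc m} _ λ _ → ⨁-false {n} _ λ _ → refl) }
    nothing-pending : residual S (λ _ → ∅) ≐ S
    nothing-pending u v = trans (cong (S u v xor_) (⨁-false {suc m} _ λ s → substitute-∅ (pathOf s) (λ _ _ → refl) u v))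
                                (xor-identityʳ (S u v))

  -- Congestion of the family at the edge uv

  module Load (u v : Fin n) where

    onPath : Node → Fin n → Fin n → Bool
    onPath s x y = present s x y ∧ pathOf s x y u v

    pathLoad : ℕ
    pathLoad = ∑[ s < suc m ] ∑[ x < n ] ∑[ y < n ] ⟦ onPath s x y ⟧

    isUV : Fin n → Fin n → Bool
    isUV x y = (x ≺ y) ∧ edge x y u v

    isUV-unique : ∑[ x < n ] ∑[ y < n ] ⟦ isUV x y ⟧ ≤ 1
    isUV-unique = begin
      ∑[ x < n ] ∑[ y < n ] ⟦ isUV x y ⟧
        ≤⟨ sum-mono-≤ (λ x → sum-mono-≤ λ y → split (x ≺ y) ((u == x) ∧ (v == y)) ((u == y) ∧ (v == x))) ⟩
      ∑[ x < n ] ∑[ y < n ] (⟦ (x ≺ y) ∧ ((u == x) ∧ (v == y)) ⟧ + ⟦ (x ≺ y) ∧ ((u == y) ∧ (v == x)) ⟧)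
        ≡⟨ trans (sum-cong-≗ λ x → ∑-distrib-+ (λ y → ⟦ (x ≺ y) ∧ ((u == x) ∧ (v == y)) ⟧) _)
                 (∑-distrib-+ (λ x → ∑[ y < n ] ⟦ (x ≺ y) ∧ ((u == x) ∧ (v == y)) ⟧)
                              (λ x → ∑[ y < n ] ⟦ (x ≺ y) ∧ ((u == y) ∧ (v == x)) ⟧)) ⟩
      ∑[ x < n ] ∑[ y < n ] ⟦ (x ≺ y) ∧ ((u == x) ∧ (v == y)) ⟧ +
      ∑[ x < n ] ∑[ y < n ] ⟦ (x ≺ y) ∧ ((u == y) ∧ (v == x)) ⟧
        ≡⟨ cong₂ _+_ (pick u v) (trans (sum-cong-≗ λ x → sum-cong-≗ λ y →
                                          cong (λ z → ⟦ (x ≺ y) ∧ z ⟧) (∧-comm (u == y) (v == x)))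
                                       (pick v u)) ⟩
      ⟦ u ≺ v ⟧ + ⟦ v ≺ u ⟧
        ≤⟨ oneOrientation ⟩
      1 ∎
      where
      open ≤-Reasoning
      split : ∀ l a b → ⟦ l ∧ (a xor b) ⟧ ≤ ⟦ l ∧ a ⟧ + ⟦ l ∧ b ⟧
      split false a b = z≤n
      split true a b = ⟦xor⟧≤ a b
      vanishˡ : ∀ l {a} b → a ≡ false → ⟦ l ∧ (a ∧ b) ⟧ ≡ 0
      vanishˡ l b refl = cong ⟦_⟧ (∧-zeroʳ l)
      vanishʳ : ∀ l a {b} → b ≡ false → ⟦ l ∧ (a ∧ b) ⟧ ≡ 0
      vanishʳ l a refl = cong ⟦_⟧ (trans (cong (l ∧_) (∧-zeroʳ a)) (∧-zeroʳ l))
      pick : ∀ p q → ∑[ x < n ] ∑[ y < n ] ⟦ (x ≺ y) ∧ ((p == x) ∧ (q == y)) ⟧ ≡ ⟦ p ≺ q ⟧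
      pick p q = trans (sum-single _ p λ x x≢p → sum-zero _ λ y → vanishˡ (x ≺ y) (q == y) (==-false (x≢p ∘ sym)))
                (trans (sum-single _ q λ y y≢q → vanishʳ (p ≺ y) (p == p) (==-false (y≢q ∘ sym)))
                       (trans (cong₂ (λ a b → ⟦ (p ≺ q) ∧ (a ∧ b) ⟧) (==-refl p) (==-refl q))
                              (cong ⟦_⟧ (∧-identityʳ (p ≺ q)))))
      oneOrientation : ⟦ u ≺ v ⟧ + ⟦ v ≺ u ⟧ ≤ 1
      oneOrientation with u ≺ v in uv | v ≺ u in vu
      ... | false | false = z≤n
      ... | false | true = ≤-refl
      ... | true | false = ≤-refl
      ... | true | true = ⊥-elim (<-asym (≺⇒< {x = u} {v} uv) (≺⇒< {x = v} {u} vu))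

    load-paths : ∀ x y → load (paths x y) u v ≡ ∑[ s < suc m ] ⟦ onPath s x y ⟧
    load-paths x y = load-selected (λ s → present s x y) (λ s → pathOf s x y) u v

    load-differences-joins : ∀ x y → load (differences (joins x y)) u v ≤ ⟦ isUV x y ⟧ + 2 * ∑[ s < suc m ] ⟦ onPath s x y ⟧
    load-differences-joins x y with (x ≺ y) ∧ adj x y in e
    ... | true = ≤-trans (load-differences-∷ (edge x y) (paths x y) u v)
                         (≤-reflexive (cong₂ (λ a p → ⟦ a ⟧ + 2 * p) isUV≡edge (load-paths x y)))
      where
      isUV≡edge : edge x y u v ≡ isUV x y
      isUV≡edge = cong (_∧ edge x y u v) (sym (∧-trueˡ {x ≺ y} e))
    ... | false = ≤-trans (load-differences (paths x y) u v)
                          (≤-trans (≤-reflexive (cong (2 *_) (load-paths x y))) (m≤n+m _ ⟦ isUV x y ⟧))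

    load-corrections : load corrections u v ≤ 1 + 2 * pathLoad
    load-corrections = begin
      load corrections u v
        ≡⟨ trans (load-concat-tabulate (λ x → concat (tabulate λ y → differences (joins x y))) u v)
                 (sum-cong-≗ λ x → load-concat-tabulate (λ y → differences (joins x y)) u v) ⟩
      ∑[ x < n ] ∑[ y < n ] load (differences (joins x y)) u v
        ≤⟨ sum-mono-≤ (λ x → sum-mono-≤ (load-differences-joins x)) ⟩
      ∑[ x < n ] ∑[ y < n ] (⟦ isUV x y ⟧ + 2 * ∑[ s < suc m ] ⟦ onPath s x y ⟧)
        ≡⟨ trans (sum-cong-≗ λ x → ∑-distrib-+ (λ y → ⟦ isUV x y ⟧) (λ y → 2 * ∑[ s < suc m ] ⟦ onPath s x y ⟧))
                 (∑-distrib-+ (λ x → ∑[ y < n ] ⟦ isUV x y ⟧) (λ x → ∑[ y < n ] (2 * ∑[ s < suc m ] ⟦ onPath s x y ⟧))) ⟩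
      ∑[ x < n ] ∑[ y < n ] ⟦ isUV x y ⟧ + ∑[ x < n ] ∑[ y < n ] (2 * ∑[ s < suc m ] ⟦ onPath s x y ⟧)
        ≡⟨ cong (∑[ x < n ] ∑[ y < n ] ⟦ isUV x y ⟧ +_)
                (trans (sum-cong-≗ λ x → sum-scale 2 (λ y → ∑[ s < suc m ] ⟦ onPath s x y ⟧))
                       (trans (sum-scale 2 (λ x → ∑[ y < n ] ∑[ s < suc m ] ⟦ onPath s x y ⟧))
                              (cong (2 *_) (∑-rotate λ x y s → ⟦ onPath s x y ⟧)))) ⟩
      ∑[ x < n ] ∑[ y < n ] ⟦ isUV x y ⟧ + 2 * pathLoad
        ≤⟨ +-monoˡ-≤ (2 * pathLoad) isUV-unique ⟩
      1 + 2 * pathLoad ∎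
      where open ≤-Reasoning

    usesUV : Node → Fin n → Fin n → Bool
    usesUV t x y = oriented (torso D t) x y ∧ realise t x y u v

    ⟦substitute⟧≤ : ∀ C (Φ : Fin n → Fin n → ESet n) →
                    ⟦ substitute C Φ u v ⟧ ≤ ∑[ x < n ] ∑[ y < n ] ⟦ oriented C x y ∧ Φ x y u v ⟧
    ⟦substitute⟧≤ C Φ = ≤-trans (⟦⨁⟧≤sum (λ x → ⨁ λ y → oriented C x y ∧ Φ x y u v))
                                (sum-mono-≤ λ x → ⟦⨁⟧≤sum (λ y → oriented C x y ∧ Φ x y u v))

    basis-load : ∀ t x y → ∑[ i < basisSize t ] ⟦ oriented (basisOf t i) x y ∧ realise t x y u v ⟧ ≤ b * ⟦ usesUV t x y ⟧
    basis-load t x y = byCases (x ≺ y) (realise t x y u v) (torso D t x y) refl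
      where
      B : Fin (basisSize t) → ESet n
      B = basisOf t
      byCases : ∀ l φ τ → torso D t x y ≡ τ → ∑[ i < basisSize t ] ⟦ (l ∧ B i x y) ∧ φ ⟧ ≤ b * ⟦ (l ∧ τ) ∧ φ ⟧
      byCases false φ τ _ = ≤-trans (≤-reflexive (sum-zero {basisSize t} _ λ _ → refl)) z≤n
      byCases true false τ _ = ≤-trans (≤-reflexive (sum-zero {basisSize t} _ λ i → cong ⟦_⟧ (∧-zeroʳ (B i x y)))) z≤n
      byCases true true false ¬txy = ≤-trans (≤-reflexive (sum-zero {basisSize t} _ notInTorso)) z≤n
        where
        notInTorso : ∀ i → ⟦ B i x y ∧ true ⟧ ≡ 0
        notInTorso i with B i x y in bxy
        ... | false = refl
        ... | true = ⊥-elim (false≢true (trans (sym ¬txy) (IsEdgeSubset.sub (IsCycleBasis.members-sub (basisOf-isBasis t) i) x y bxy)))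
      byCases true true true _ = begin
        ∑[ i < basisSize t ] ⟦ B i x y ∧ true ⟧ ≡⟨ sum-cong-≗ (λ i → cong ⟦_⟧ (∧-identityʳ (B i x y))) ⟩
        ∑[ i < basisSize t ] ⟦ B i x y ⟧        ≡⟨ sym (sumFin≡sum (λ i → ⟦ B i x y ⟧)) ⟩
        count (λ i → B i x y)                   ≤⟨ basisOf-congestion t x y ⟩
        b                                       ≡⟨ sym (*-identityʳ b) ⟩
        b * 1                                   ∎
        where open ≤-Reasoning

    load-images : load images u v ≤ b * ∑[ t < suc m ] ∑[ x < n ] ∑[ y < n ] ⟦ usesUV t x y ⟧
    load-images = begin
      load images u v
        ≡⟨ trans (load-concat-tabulate (λ t → tabulate (image t)) u v) (sum-cong-≗ λ t → load-tabulate (image t) u v) ⟩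
      ∑[ t < suc m ] ∑[ i < basisSize t ] ⟦ image t i u v ⟧
        ≤⟨ sum-mono-≤ (λ t → sum-mono-≤ λ i → ⟦substitute⟧≤ (basisOf t i) (realise t)) ⟩
      ∑[ t < suc m ] ∑[ i < basisSize t ] ∑[ x < n ] ∑[ y < n ] ⟦ oriented (basisOf t i) x y ∧ realise t x y u v ⟧
        ≡⟨ sum-cong-≗ (λ t → sym (∑-rotate λ x y i → ⟦ oriented (basisOf t i) x y ∧ realise t x y u v ⟧)) ⟩
      ∑[ t < suc m ] ∑[ x < n ] ∑[ y < n ] ∑[ i < basisSize t ] ⟦ oriented (basisOf t i) x y ∧ realise t x y u v ⟧
        ≤⟨ sum-mono-≤ (λ t → sum-mono-≤ λ x → sum-mono-≤ λ y → basis-load t x y) ⟩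
      ∑[ t < suc m ] ∑[ x < n ] ∑[ y < n ] (b * ⟦ usesUV t x y ⟧)
        ≡⟨ trans (sum-cong-≗ λ t → trans (sum-cong-≗ λ x → sum-scale b (λ y → ⟦ usesUV t x y ⟧))
                                         (sum-scale b (λ x → ∑[ y < n ] ⟦ usesUV t x y ⟧)))
                 (sum-scale b (λ t → ∑[ x < n ] ∑[ y < n ] ⟦ usesUV t x y ⟧)) ⟩
      b * ∑[ t < suc m ] ∑[ x < n ] ∑[ y < n ] ⟦ usesUV t x y ⟧ ∎
      where open ≤-Reasoning

    ownedUV : Node → Fin n → Fin n → Bool
    ownedUV t x y = owns t x y ∧ isUV x y

    viaChild : Node → Fin n → Fin n → Bool
    viaChild t x y = isChildOf D c t ∧ onPath c x y
      where
      c : Node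
      c = firstTrue (childWith t x y)

    usesUV-cases : ∀ t x y → usesUV t x y ≡ true → ((onPath t x y ∨ ownedUV t x y) ∨ viaChild t x y) ≡ true
    usesUV-cases t x y e = byCases (A t x ∧ A t y) refl (adj x y) refl
      where
      x≺y : (x ≺ y) ≡ true
      x≺y = ∧-trueˡ {x ≺ y} (∧-trueˡ {oriented (torso D t) x y} e)
      txy : torso D t x y ≡ true
      txy = ∧-trueʳ {x ≺ y} (∧-trueˡ {oriented (torso D t) x y} e)
      uv : realise t x y u v ≡ true
      uv = ∧-trueʳ {oriented (torso D t) x y} e
      on : ∀ {Z} → realise t x y ≡ Z → Z u v ≡ true
      on eq = subst (λ Z → Z u v ≡ true) eq uv
      byCases : ∀ a → (A t x ∧ A t y) ≡ a → ∀ e → adj x y ≡ e → ((onPath t x y ∨ ownedUV t x y) ∨ viaChild t x y) ≡ true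
      byCases true axy _ _ = ∨-introˡ (∨-introˡ (∧-true (∧-true x≺y axy) (on (realise-adhesion t x y axy))))
      byCases false axy true xy = ∨-introˡ (∨-introʳ {onPath t x y}
        (∧-true (∧-true (∧-trueˡ {bag t x} txy) (∧-true (∧-trueˡ {bag t y} (∧-trueʳ {bag t x} txy)) (cong not axy)))
                (∧-true x≺y (on (realise-edge t x y axy xy)))))
      byCases false axy false ¬xy = ∨-introʳ {onPath t x y ∨ ownedUV t x y}
        (∧-true (∧-trueˡ {isChildOf D c t} carries)
                (∧-true (∧-true x≺y (∧-trueʳ {isChildOf D c t} carries)) (on (realise-child t x y axy ¬xy))))
        where
        c : Node
        c = firstTrue (childWith t x y)
        carries : childWith t x y c ≡ true
        carries = firstTrue-true (childWith t x y)
                    (trans (sym (cong₂ (λ p q → p ∨ q ∨ anyFin (childWith t x y)) ¬xy axy)) (torso-reason t x y txy))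

    ownedUV-unique : ∑[ t < suc m ] ∑[ x < n ] ∑[ y < n ] ⟦ ownedUV t x y ⟧ ≤ 1
    ownedUV-unique = begin
      ∑[ t < suc m ] ∑[ x < n ] ∑[ y < n ] ⟦ ownedUV t x y ⟧ ≡⟨ sym (∑-rotate λ x y t → ⟦ ownedUV t x y ⟧) ⟩
      ∑[ x < n ] ∑[ y < n ] ∑[ t < suc m ] ⟦ ownedUV t x y ⟧
        ≤⟨ sum-mono-≤ (λ x → sum-mono-≤ λ y → sum-⟦∧⟧-unique (λ t → owns t x y) (isUV x y) (owner-unique x y)) ⟩
      ∑[ x < n ] ∑[ y < n ] ⟦ isUV x y ⟧                  ≤⟨ isUV-unique ⟩
      1                                                    ∎
      where open ≤-Reasoning

    viaChild-load : ∑[ t < suc m ] ∑[ x < n ] ∑[ y < n ] ⟦ viaChild t x y ⟧ ≤ pathLoad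
    viaChild-load = begin
      ∑[ t < suc m ] ∑[ x < n ] ∑[ y < n ] ⟦ viaChild t x y ⟧ ≡⟨ sym (∑-rotate λ x y t → ⟦ viaChild t x y ⟧) ⟩
      ∑[ x < n ] ∑[ y < n ] ∑[ t < suc m ] ⟦ viaChild t x y ⟧ ≤⟨ sum-mono-≤ (λ x → sum-mono-≤ (atMostOneParent x)) ⟩
      ∑[ x < n ] ∑[ y < n ] ∑[ s < suc m ] ⟦ onPath s x y ⟧  ≡⟨ ∑-rotate (λ x y s → ⟦ onPath s x y ⟧) ⟩
      pathLoad                                                ∎
      where
      open ≤-Reasoning
      atMostOneParent : ∀ x y → ∑[ t < suc m ] ⟦ viaChild t x y ⟧ ≤ ∑[ s < suc m ] ⟦ onPath s x y ⟧
      atMostOneParent x y = begin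
        ∑[ t < suc m ] ⟦ viaChild t x y ⟧
          ≤⟨ sum-mono-≤ (λ t → ≤-sum (λ s → ⟦ isChildOf D s t ∧ onPath s x y ⟧) (firstTrue (childWith t x y))) ⟩
        ∑[ t < suc m ] ∑[ s < suc m ] ⟦ isChildOf D s t ∧ onPath s x y ⟧
          ≡⟨ ∑-comm (λ t s → ⟦ isChildOf D s t ∧ onPath s x y ⟧) ⟩
        ∑[ s < suc m ] ∑[ t < suc m ] ⟦ isChildOf D s t ∧ onPath s x y ⟧
          ≤⟨ sum-mono-≤ (λ s → sum-⟦∧⟧-unique (isChildOf D s) (onPath s x y) (parent-unique s)) ⟩
        ∑[ s < suc m ] ⟦ onPath s x y ⟧ ∎

    usesUV-load : ∑[ t < suc m ] ∑[ x < n ] ∑[ y < n ] ⟦ usesUV t x y ⟧ ≤ pathLoad + 1 + pathLoad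
    usesUV-load = begin
      ∑[ t < suc m ] ∑[ x < n ] ∑[ y < n ] ⟦ usesUV t x y ⟧
        ≤⟨ sum-mono-≤ (λ t → sum-mono-≤ λ x → sum-mono-≤ λ y → threeWays t x y) ⟩
      ∑[ t < suc m ] ∑[ x < n ] ∑[ y < n ] (⟦ onPath t x y ⟧ + ⟦ ownedUV t x y ⟧ + ⟦ viaChild t x y ⟧)
        ≡⟨ trans (∑₃-distrib-+ (λ t x y → ⟦ onPath t x y ⟧ + ⟦ ownedUV t x y ⟧) (λ t x y → ⟦ viaChild t x y ⟧))
                 (cong (_+ ∑[ t < suc m ] ∑[ x < n ] ∑[ y < n ] ⟦ viaChild t x y ⟧)
                       (∑₃-distrib-+ (λ t x y → ⟦ onPath t x y ⟧) (λ t x y → ⟦ ownedUV t x y ⟧))) ⟩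
      pathLoad + ∑[ t < suc m ] ∑[ x < n ] ∑[ y < n ] ⟦ ownedUV t x y ⟧ + ∑[ t < suc m ] ∑[ x < n ] ∑[ y < n ] ⟦ viaChild t x y ⟧
        ≤⟨ +-mono-≤ (+-monoʳ-≤ pathLoad ownedUV-unique) viaChild-load ⟩
      pathLoad + 1 + pathLoad ∎
      where
      open ≤-Reasoning
      threeWays : ∀ t x y → ⟦ usesUV t x y ⟧ ≤ ⟦ onPath t x y ⟧ + ⟦ ownedUV t x y ⟧ + ⟦ viaChild t x y ⟧
      threeWays t x y = ≤-trans (⟦⟧-mono (usesUV-cases t x y))
                                (≤-trans (⟦∨⟧≤ (onPath t x y ∨ ownedUV t x y) (viaChild t x y))
                                         (+-monoˡ-≤ _ (⟦∨⟧≤ (onPath t x y) (ownedUV t x y))))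
      ∑₃-distrib-+ : ∀ (f g : Node → Fin n → Fin n → ℕ) →
        ∑[ t < suc m ] ∑[ x < n ] ∑[ y < n ] (f t x y + g t x y) ≡
        ∑[ t < suc m ] ∑[ x < n ] ∑[ y < n ] f t x y + ∑[ t < suc m ] ∑[ x < n ] ∑[ y < n ] g t x y
      ∑₃-distrib-+ f g = trans (sum-cong-≗ λ t → trans (sum-cong-≗ λ x → ∑-distrib-+ (f t x) (g t x))
                                                       (∑-distrib-+ (λ x → sum (f t x)) (λ x → sum (g t x))))
                               (∑-distrib-+ (λ t → ∑[ x < n ] sum (f t x)) (λ t → ∑[ x < n ] sum (g t x)))

    load-family : load family u v ≤ (2 * pathLoad + 1) * (b + 1)
    load-family = begin
      load family u v                                        ≡⟨ load-++ images corrections u v ⟩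
      load images u v + load corrections u v
        ≤⟨ +-mono-≤ (≤-trans load-images (*-monoʳ-≤ b usesUV-load)) load-corrections ⟩
      b * (pathLoad + 1 + pathLoad) + (1 + 2 * pathLoad)     ≡⟨ collect pathLoad b ⟩
      (2 * pathLoad + 1) * (b + 1)                           ∎
      where
      open ≤-Reasoning
      collect : ∀ p b → b * (p + 1 + p) + (1 + 2 * p) ≡ (2 * p + 1) * (b + 1)
      collect = solve-∀

  pathLoad≤ : ∀ {c} → PathCongestionAtMost D P c → ∀ u v → Load.pathLoad u v ≤ c
  pathLoad≤ {c} congestion u v = subst (_≤ c) asSum (congestion u v)
    where
    term : Node → Fin n → Fin n → Bool
    term s x y = (x ≺ y) ∧ A s x ∧ A s y ∧ hasEdge u v (P s x y)
    asSum : sumFin (λ s → sumFin (λ x → count (term s x))) ≡ Load.pathLoad u v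
    asSum = begin
      sumFin (λ s → sumFin (λ x → count (term s x)))  ≡⟨ sumFin≡sum (λ s → sumFin (λ x → count (term s x))) ⟩
      ∑[ s < suc m ] sumFin (λ x → count (term s x))  ≡⟨ sum-cong-≗ (λ s → sumFin≡sum (λ x → count (term s x))) ⟩
      ∑[ s < suc m ] ∑[ x < n ] count (term s x)
        ≡⟨ sum-cong-≗ (λ s → sum-cong-≗ λ x → sumFin≡sum (λ y → ⟦ term s x y ⟧)) ⟩
      ∑[ s < suc m ] ∑[ x < n ] ∑[ y < n ] ⟦ term s x y ⟧
        ≡⟨ sum-cong-≗ (λ s → sum-cong-≗ λ x → sum-cong-≗ λ y →
                         cong ⟦_⟧ (reassoc (x ≺ y) (A s x) (A s y) (hasEdge u v (P s x y)))) ⟩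
      Load.pathLoad u v ∎
      where
      open ≡-Reasoning
      reassoc : ∀ a b c d → a ∧ b ∧ c ∧ d ≡ (a ∧ b ∧ c) ∧ d
      reassoc a b c d = trans (cong (a ∧_) (sym (∧-assoc b c d))) (sym (∧-assoc a (b ∧ c) d))

theorem3p1 : ∀ {n : ℕ} (adj : Adj n) → IsGraph adj →
    (D : TreeDecomposition adj) → (b c : ℕ) →
    (∀ t → BnAtMost (torso D t) b) →
    (P : PathFamily D) → CapturesAdhesions D P → PathCongestionAtMost D P c →
    BnAtMost adj ((2 * c + 1) * (b + 1))
theorem3p1 {n} adj G D b c torsoBasis P captures congestion = length members , lookup members , isBasis , congestion′
  where
  open Construction G D b torsoBasis P captures
  open Joins G using (IsCycle)
  asF2Cycle : ∀ {Z} → IsCycle Z → IsEdgeSubset adj Z × IsF2Cycle Z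
  asF2Cycle {Z} (Z⊆G , even) = Z⊆G , λ v → ⨁-false⇒even (Z v) (even v)
  basis : IndependentSubfamily (λ Z → IsEdgeSubset adj Z × IsF2Cycle Z) family
  basis = independentSubfamily family (All.map asF2Cycle family-isCycle)
  open IndependentSubfamily basis
  isBasis : IsCycleBasis adj (lookup members)
  isBasis = record
    { members-sub = λ i → proj₁ (All.lookup all-P (∈-lookup i))
    ; members-cycle = λ i → proj₂ (All.lookup all-P (∈-lookup i))
    ; independent = independent
    ; spanning = λ S S⊆G S-cycle → InSpan⇒combination spans (cycle-inSpan S S⊆G S-cycle) }
  congestion′ : CongestionAtMost (lookup members) ((2 * c + 1) * (b + 1))
  congestion′ u v = begin
    count (λ i → lookup members i u v)        ≡⟨ count-lookup members u v ⟩
    load members u v                          ≤⟨ load-≤ u v ⟩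
    load family u v                           ≤⟨ Load.load-family u v ⟩
    (2 * Load.pathLoad u v + 1) * (b + 1)     ≤⟨ *-monoˡ-≤ (b + 1) (+-monoˡ-≤ 1 (*-monoʳ-≤ 2 (pathLoad≤ congestion u v))) ⟩
    (2 * c + 1) * (b + 1)                     ∎
    where open ≤-Reasoning
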